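{- Let $M \geq N \geq 1$ be integers, let $\mathbb{F}$ be a field, and let $c_0, \ldots, c_{N-1} \in \mathbb{F}$ be non-zero. For a scalar $t$ define the polynomial $p_t(z) := t(c_0 + c_1 z + \cdots + c_{N-1} z^{N-1}) - z^M$. For $0 \leq j < N$ let $\mu(M,N,j)$ be the hook partition $(M-N+1, 1, \ldots, 1, 0, \ldots, 0)$ with $N-j-1$ ones and $j$ zeros (a partition with $N$ parts). Then for all $\mathbf{u}, \mathbf{v} \in \mathbb{F}^N$, $$\det p_t[\mathbf{u}\mathbf{v}^T] = t^{N-1} \Delta_N(\mathbf{u}) \Delta_N(\mathbf{v}) \prod_{j=0}^{N-1} c_j \Bigl( t - \sum_{j=0}^{N-1} \frac{s_{\mu(M,N,j)}(\mathbf{u})\, s_{\mu(M,N,j)}(\mathbf{v})}{c_j} \Bigr)$$ (as an identity of polynomials in $t$). Moreover, $s_{\mu(M,N,j)}(1, \ldots, 1) = \binom{M}{j}\binom{M-j-1}{N-j-1}$ for all $0 \leq j < N$.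
   Context: For $\mathbf{u} = (u_1,\ldots,u_N)$, $\Delta_N(\mathbf{u}) := \prod_{1 \leq i < j \leq N}(u_i - u_j)$ is the Vandermonde determinant $\det(u_i^{N-j})$. For a partition $\mathbf{n} = (n_N \geq n_{N-1} \geq \cdots \geq n_1 \geq 0)$ of integers, the Schur polynomial $s_{\mathbf{n}}(x_1,\ldots,x_N)$ is the unique polynomial (with integer coefficients) that equals $\det(x_i^{n_j + N - j})/\det(x_i^{N-j})$ whenever the $x_i$ are pairwise distinct; here the partition is listed with its largest part first. For a polynomial $p$ and a matrix $A = (a_{jk})$, $p[A] := (p(a_{jk}))$ denotes entrywise application. -}

module Defs where

open import Level using (Level; 0ℓ; _⊔_)
open import Data.Nat using (ℕ; zero; suc; _∸_; _<ᵇ_; _≡ᵇ_)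
  renaming (_+_ to _+ℕ_)
open import Data.Bool using (if_then_else_)
open import Data.Fin using (Fin; toℕ; punchIn)
  renaming (zero to fzero; suc to fsuc)
open import Algebra.Bundles using (CommutativeRing)
open import Algebra.Bundles.Raw using (RawRing)
open import Relation.Nullary using (¬_)

-- Fields: a commutative ring with 0 ≉ 1 in which every non-zero element
-- has a multiplicative inverse (inverse given as a total function whose
-- value on 0 is irrelevant, as usual).

record Field (c ℓ : Level) : Set (Level.suc (c ⊔ ℓ)) where
  field
    commutativeRing : CommutativeRing c ℓ
  open CommutativeRing commutativeRing public
  field
    _⁻¹       : Carrier → Carrier
    0≉1       : ¬ (0# ≈ 1#)
    ⁻¹-inverse : ∀ x → ¬ (x ≈ 0#) → (x * (x ⁻¹)) ≈ 1#

module RingOps {c ℓ} (R : RawRing c ℓ) where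
  open RawRing R

  sumᶠ : ∀ n → (Fin n → Carrier) → Carrier
  sumᶠ zero    f = 0#
  sumᶠ (suc n) f = f fzero + sumᶠ n (λ i → f (fsuc i))

  prodᶠ : ∀ n → (Fin n → Carrier) → Carrier
  prodᶠ zero    f = 1#
  prodᶠ (suc n) f = f fzero * prodᶠ n (λ i → f (fsuc i))

  pow : Carrier → ℕ → Carrier
  pow x zero    = 1#
  pow x (suc k) = x * pow x k

  sign : ℕ → Carrier
  sign zero    = 1#
  sign (suc k) = - sign k

  det : ∀ n → (Fin n → Fin n → Carrier) → Carrier
  det zero    A = 1#
  det (suc n) A =
    sumᶠ (suc n) (λ j → sign (toℕ j) * (A fzero j *
      det n (λ i k → A (fsuc i) (punchIn j k))))

  vandermonde : ∀ n → (Fin n → Carrier) → Carrier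
  vandermonde n u = prodᶠ n (λ i → prodᶠ n (λ j →
    if toℕ i <ᵇ toℕ j then u i + (- u j) else 1#))

-- Polynomials with integer coefficients in N variables, as expressions
-- (generated by 0, 1, variables, +, *, negation), evaluated in any ring.

data Expr (N : ℕ) : Set where
  zer : Expr N
  one : Expr N
  var : Fin N → Expr N
  add : Expr N → Expr N → Expr N
  mul : Expr N → Expr N → Expr N
  neg : Expr N → Expr N

eval : ∀ {c ℓ} (R : RawRing c ℓ) {N} → (Fin N → RawRing.Carrier R) →
       Expr N → RawRing.Carrier R
eval R x zer       = RawRing.0# R
eval R x one       = RawRing.1# R
eval R x (var i)   = x i
eval R x (add e f) = RawRing._+_ R (eval R x e) (eval R x f)
eval R x (mul e f) = RawRing._*_ R (eval R x e) (eval R x f)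
eval R x (neg e)   = RawRing.-_ R (eval R x e)

-- A partition with N parts, listed largest first: λ : Fin N → ℕ
-- (λ 0 ≥ λ 1 ≥ … ≥ λ (N-1)).
Partition : ℕ → Set
Partition N = Fin N → ℕ

-- "e is the Schur polynomial s_λ": e · Δ_N(x) = det(x_i^{λ_j + N - 1 - j})
-- as an identity in ℤ[x_1,…,x_N], i.e. it holds in every commutative ring
-- (ℤ[x_1,…,x_N] being one of them) for every choice of the variables.
IsSchur : ∀ N → Partition N → Expr N → Set₁
IsSchur N λp e =
  (R : CommutativeRing 0ℓ 0ℓ) (x : Fin N → CommutativeRing.Carrier R) →
  let open CommutativeRing R
      open RingOps rawRing
  in (eval rawRing x e * vandermonde N x)
       ≈ det N (λ i j → pow (x i) (λp j +ℕ (N ∸ suc (toℕ j))))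

hook : (M N : ℕ) → Fin N → Partition N
hook M N j i =
  if toℕ i ≡ᵇ 0 then suc (M ∸ N)
  else if toℕ i <ᵇ (N ∸ toℕ j) then 1 else 0

-- Formal power series in one variable t over a field: coefficient
-- sequences ℕ → F. Polynomials in t embed faithfully, so an identity of
-- polynomials in t is coefficientwise equality here.

module Series {c ℓ} (F : Field c ℓ) where
  open Field F
  private module FO = RingOps rawRing

  PS : Set c
  PS = ℕ → Carrier

  conv : PS → PS → ℕ → Carrier
  conv a b n = FO.sumᶠ (suc n) (λ k → a (toℕ k) * b (n ∸ toℕ k))

  psRing : RawRing c ℓ
  psRing = record
    { Carrier = PS
    ; _≈_ = λ a b → ∀ n → a n ≈ b n
    ; _+_ = λ a b n → a n + b n
    ; _*_ = conv
    ; -_  = λ a n → - a n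
    ; 0#  = λ _ → 0#
    ; 1#  = λ { zero → 1# ; (suc _) → 0# }
    }

  const : Carrier → PS
  const a zero    = a
  const a (suc _) = 0#

  tVar : PS
  tVar (suc zero) = 1#
  tVar _          = 0#

module Submission where

-- Write p_t(u_i v_k) = Σ_l w_l(v_k) u_i^(e_l) over the N+1 exponents
-- e_l ∈ {M, N-1, …, 1, 0} of p_t. By Cauchy–Binet, det p_t[u vᵀ] is a sum
-- over the exponent left out. Leaving out z^M gives t^N Π c Δ(u) Δ(v);
-- leaving out z^j leaves exactly the shifted exponents of the hook μ(M,N,j),
-- so that term is -t^(N-1) Π_{m≠j} c_m s_μ(u) Δ(u) s_μ(v) Δ(v), and
-- Π_{m≠j} c_m = Π c / c_j. For s_μ(1, …, 1), specialise the defining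
-- identity of s_μ at x_i = q^(N-1-i) and let q → 1; for a hook both
-- resulting Vandermonde products are explicit products of factorials.

open import Level using (_⊔_; 0ℓ; Lift; lift)
open import Data.Unit using (tt)
open import Data.Bool using (Bool; true; false; if_then_else_)
open import Data.Nat as ℕ using (ℕ; zero; suc; _<_; _≤_; _∸_; _<ᵇ_; s≤s; z≤n; _!)
  renaming (_+_ to _+ℕ_; _*_ to _*ℕ_)
import Data.Nat.Properties as ℕ
open import Data.Fin using (Fin; toℕ; punchIn; punchOut; inject₁; fromℕ; opposite)
  renaming (zero to fzero; suc to fsuc)
open import Data.Fin.Properties
  using (punchIn-punchOut; punchInᵢ≢i; punchIn-injective; toℕ-inject₁; toℕ-fromℕ;
         opposite-prop; opposite-involutive; toℕ≤pred[n])
  renaming (_≟_ to _≟ᶠ_)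
open import Data.Vec.Functional using (_∷_; head; tail)
open import Data.Product using (Σ; _,_; _×_)
open import Data.Sum using (inj₁; inj₂)
open import Relation.Nullary using (¬_; yes; no; contradiction)
open import Relation.Binary.PropositionalEquality as ≡ using (_≡_; _≢_)
open import Algebra.Bundles using (CommutativeRing)
open import Algebra.Bundles.Raw using (RawRing)
open import Algebra.Morphism.Structures using (IsRingHomomorphism)
open import Defs

_[_]≔_ : ∀ {a} {A : Set a} {m} → (Fin m → A) → Fin m → A → Fin m → A
Q [ fzero  ]≔ x = x ∷ tail Q
Q [ fsuc p ]≔ x = head Q ∷ (tail Q [ p ]≔ x)

[]≔-updates : ∀ {a} {A : Set a} {m} (Q : Fin m → A) p x → (Q [ p ]≔ x) p ≡ x
[]≔-updates Q fzero    x = ≡.refl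
[]≔-updates Q (fsuc p) x = []≔-updates (tail Q) p x

[]≔-minimal : ∀ {a} {A : Set a} {m} (Q : Fin m → A) p x k → k ≢ p → (Q [ p ]≔ x) k ≡ Q k
[]≔-minimal Q fzero    x fzero    k≢p = contradiction ≡.refl k≢p
[]≔-minimal Q fzero    x (fsuc k) k≢p = ≡.refl
[]≔-minimal Q (fsuc p) x fzero    k≢p = ≡.refl
[]≔-minimal Q (fsuc p) x (fsuc k) k≢p = []≔-minimal (tail Q) p x k (λ e → k≢p (≡.cong fsuc e))

∸-toℕ : ∀ m (q : Fin m) → m ∸ toℕ q ≡ suc (m ∸ suc (toℕ q))
∸-toℕ (suc m) fzero    = ≡.refl
∸-toℕ (suc m) (fsuc q) = ∸-toℕ m q

module BigOperators {c ℓ} (R : CommutativeRing c ℓ) where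
  open CommutativeRing R public
  open RingOps rawRing public
  open import Relation.Binary.Reasoning.Setoid setoid public
  open import Algebra.Properties.Ring ring public
    using (-0#≈0#; -‿involutive; -‿distribˡ-*; -‿distribʳ-*; -‿+-comm; +-inverseʳ-unique)
  open import Algebra.Properties.CommutativeSemigroup +-commutativeSemigroup public
    using () renaming (interchange to +-interchange; x∙yz≈y∙xz to x+yz≈y+xz)
  open import Algebra.Properties.CommutativeSemigroup *-commutativeSemigroup public
    using () renaming (interchange to *-interchange; x∙yz≈y∙xz to x*yz≈y*xz)
  open import Algebra.Solver.CommutativeMonoid *-commutativeMonoid public
    using (solve; _⊜_) renaming (_⊕_ to _⊗_)

  -1*x≈-x : ∀ x → (- 1#) * x ≈ - x
  -1*x≈-x x = trans (sym (-‿distribˡ-* 1# x)) (-‿cong (*-identityˡ x))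

  sumᶠ-cong : ∀ n {f g : Fin n → Carrier} → (∀ i → f i ≈ g i) → sumᶠ n f ≈ sumᶠ n g
  sumᶠ-cong zero    eq = refl
  sumᶠ-cong (suc n) eq = +-cong (eq fzero) (sumᶠ-cong n (λ i → eq (fsuc i)))

  sumᶠ-+ : ∀ n (f g : Fin n → Carrier) → sumᶠ n (λ i → f i + g i) ≈ sumᶠ n f + sumᶠ n g
  sumᶠ-+ zero    f g = sym (+-identityʳ 0#)
  sumᶠ-+ (suc n) f g = trans (+-cong refl (sumᶠ-+ n (tail f) (tail g))) (+-interchange _ _ _ _)

  sumᶠ-0 : ∀ n (f : Fin n → Carrier) → (∀ i → f i ≈ 0#) → sumᶠ n f ≈ 0#
  sumᶠ-0 zero    f eq = refl
  sumᶠ-0 (suc n) f eq = trans (+-cong (eq fzero) (sumᶠ-0 n _ (λ i → eq (fsuc i)))) (+-identityʳ 0#)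

  *-distribˡ-sumᶠ : ∀ n x (f : Fin n → Carrier) → x * sumᶠ n f ≈ sumᶠ n (λ i → x * f i)
  *-distribˡ-sumᶠ zero    x f = zeroʳ x
  *-distribˡ-sumᶠ (suc n) x f = trans (distribˡ x _ _) (+-cong refl (*-distribˡ-sumᶠ n x (tail f)))

  -‿sumᶠ : ∀ n (f : Fin n → Carrier) → - sumᶠ n f ≈ sumᶠ n (λ i → - f i)
  -‿sumᶠ zero    f = -0#≈0#
  -‿sumᶠ (suc n) f = trans (sym (-‿+-comm _ _)) (+-cong refl (-‿sumᶠ n (tail f)))

  sumᶠ-punchIn : ∀ n (f : Fin (suc n) → Carrier) (p : Fin (suc n)) →
    sumᶠ (suc n) f ≈ f p + sumᶠ n (λ k → f (punchIn p k))
  sumᶠ-punchIn n       f fzero    = refl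
  sumᶠ-punchIn (suc n) f (fsuc p) =
    trans (+-cong refl (sumᶠ-punchIn n (tail f) p)) (x+yz≈y+xz _ _ _)

  sumᶠ-last : ∀ n (f : Fin (suc n) → Carrier) → sumᶠ (suc n) f ≈ sumᶠ n (λ k → f (inject₁ k)) + f (fromℕ n)
  sumᶠ-last zero    f = trans (+-identityʳ _) (sym (+-identityˡ _))
  sumᶠ-last (suc n) f = trans (+-cong refl (sumᶠ-last n (tail f))) (sym (+-assoc _ _ _))

  sumᶠ-opposite : ∀ n (f : Fin n → Carrier) → sumᶠ n (λ i → f (opposite i)) ≈ sumᶠ n f
  sumᶠ-opposite zero    f = refl
  sumᶠ-opposite (suc n) f = trans (+-cong refl (sumᶠ-opposite n (λ i → f (inject₁ i))))
    (trans (+-comm _ _) (sym (sumᶠ-last n f)))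

  prodᶠ-cong : ∀ n {f g : Fin n → Carrier} → (∀ i → f i ≈ g i) → prodᶠ n f ≈ prodᶠ n g
  prodᶠ-cong zero    eq = refl
  prodᶠ-cong (suc n) eq = *-cong (eq fzero) (prodᶠ-cong n (λ i → eq (fsuc i)))

  prodᶠ-* : ∀ n (f g : Fin n → Carrier) → prodᶠ n (λ i → f i * g i) ≈ prodᶠ n f * prodᶠ n g
  prodᶠ-* zero    f g = sym (*-identityʳ 1#)
  prodᶠ-* (suc n) f g = trans (*-cong refl (prodᶠ-* n (tail f) (tail g))) (*-interchange _ _ _ _)

  prodᶠ-punchIn : ∀ n (f : Fin (suc n) → Carrier) (p : Fin (suc n)) →
    prodᶠ (suc n) f ≈ f p * prodᶠ n (λ k → f (punchIn p k))
  prodᶠ-punchIn n       f fzero    = refl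
  prodᶠ-punchIn (suc n) f (fsuc p) = trans (*-cong refl (prodᶠ-punchIn n (tail f) p)) (x*yz≈y*xz _ _ _)

  prodᶠ-last : ∀ n (f : Fin (suc n) → Carrier) → prodᶠ (suc n) f ≈ prodᶠ n (λ k → f (inject₁ k)) * f (fromℕ n)
  prodᶠ-last zero    f = trans (*-identityʳ _) (sym (*-identityˡ _))
  prodᶠ-last (suc n) f = trans (*-cong refl (prodᶠ-last n (tail f))) (sym (*-assoc _ _ _))

  prodᶠ-opposite : ∀ n (f : Fin n → Carrier) → prodᶠ n (λ i → f (opposite i)) ≈ prodᶠ n f
  prodᶠ-opposite zero    f = refl
  prodᶠ-opposite (suc n) f = trans (*-cong refl (prodᶠ-opposite n (λ i → f (inject₁ i))))
    (trans (*-comm _ _) (sym (prodᶠ-last n f)))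

  prodᶠ-const : ∀ n x → prodᶠ n (λ _ → x) ≈ pow x n
  prodᶠ-const zero    x = refl
  prodᶠ-const (suc n) x = *-cong refl (prodᶠ-const n x)

  sign*prodᶠ : ∀ m (f : Fin m → Carrier) → sign m * prodᶠ m f ≈ prodᶠ m (λ i → - f i)
  sign*prodᶠ zero    f = *-identityˡ _
  sign*prodᶠ (suc m) f = begin
    (- sign m) * (f fzero * prodᶠ m (tail f)) ≈⟨ sym (-‿distribˡ-* _ _) ⟩
    - (sign m * (f fzero * prodᶠ m (tail f))) ≈⟨ -‿cong (x*yz≈y*xz _ _ _) ⟩
    - (f fzero * (sign m * prodᶠ m (tail f))) ≈⟨ -‿distribˡ-* _ _ ⟩
    (- f fzero) * (sign m * prodᶠ m (tail f)) ≈⟨ *-cong refl (sign*prodᶠ m _) ⟩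
    (- f fzero) * prodᶠ m (λ i → - f (fsuc i)) ∎

  sign*sign : ∀ a → sign a * sign a ≈ 1#
  sign*sign zero    = *-identityʳ 1#
  sign*sign (suc a) = trans -x*-x≈x*x (sign*sign a)
    where
    -x*-x≈x*x : ∀ {x} → (- x) * (- x) ≈ x * x
    -x*-x≈x*x {x} = trans (sym (-‿distribˡ-* x (- x)))
      (trans (-‿cong (sym (-‿distribʳ-* x x))) (-‿involutive _))

  pow-* : ∀ x y k → pow (x * y) k ≈ pow x k * pow y k
  pow-* x y zero    = sym (*-identityʳ 1#)
  pow-* x y (suc k) = trans (*-cong refl (pow-* x y k)) (*-interchange _ _ _ _)

  pow-+ : ∀ x a b → pow x (a +ℕ b) ≈ pow x a * pow x b
  pow-+ x zero    b = sym (*-identityˡ _)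
  pow-+ x (suc a) b = trans (*-cong refl (pow-+ x a b)) (sym (*-assoc _ _ _))

  pow-pow : ∀ x a b → pow (pow x a) b ≈ pow x (a *ℕ b)
  pow-pow x a zero    = reflexive (≡.cong (pow x) (≡.sym (ℕ.*-zeroʳ a)))
  pow-pow x a (suc b) = trans (*-cong refl (pow-pow x a b))
    (trans (sym (pow-+ x a _)) (reflexive (≡.cong (pow x) (≡.sym (ℕ.*-suc a b)))))

  pow-comm : ∀ x a b → pow (pow x a) b ≈ pow (pow x b) a
  pow-comm x a b = trans (pow-pow x a b)
    (trans (reflexive (≡.cong (pow x) (ℕ.*-comm a b))) (sym (pow-pow x b a)))

  if-cong : ∀ (b : Bool) {x x' y y'} → x ≈ x' → y ≈ y' → (if b then x else y) ≈ (if b then x' else y')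
  if-cong true  ex ey = ex
  if-cong false ex ey = ey

  vandermonde-cong : ∀ n {x y : Fin n → Carrier} → (∀ i → x i ≈ y i) → vandermonde n x ≈ vandermonde n y
  vandermonde-cong n e = prodᶠ-cong n (λ i → prodᶠ-cong n (λ j →
    if-cong (toℕ i <ᵇ toℕ j) (+-cong (e i) (-‿cong (e j))) refl))

  vandermonde-∷ : ∀ m (x : Fin (suc m) → Carrier) →
    vandermonde (suc m) x ≈ prodᶠ m (λ j → x fzero + - x (fsuc j)) * vandermonde m (tail x)
  vandermonde-∷ m x = *-cong (*-identityˡ _) (prodᶠ-cong m (λ i → *-identityˡ _))

  -- t ^ (n choose 2), written as the product defining the Vandermonde.
  triangularPow : ∀ n → Carrier → Carrier
  triangularPow n t = prodᶠ n (λ i → prodᶠ n (λ j → if toℕ i <ᵇ toℕ j then t else 1#))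

  vandermonde-affine : ∀ n w t (z : Fin n → Carrier) →
    vandermonde n (λ i → w + t * z i) ≈ triangularPow n t * vandermonde n z
  vandermonde-affine n w t z = trans
    (prodᶠ-cong n (λ i → trans (prodᶠ-cong n (λ j → factor (toℕ i <ᵇ toℕ j) i j)) (prodᶠ-* n _ _)))
    (prodᶠ-* n _ _)
    where
    factor : ∀ b i j → (if b then (w + t * z i) + - (w + t * z j) else 1#) ≈
                       (if b then t else 1#) * (if b then z i + - z j else 1#)
    factor true  i j = begin
      (w + t * z i) + - (w + t * z j)      ≈⟨ +-cong refl (sym (-‿+-comm _ _)) ⟩
      (w + t * z i) + (- w + - (t * z j))  ≈⟨ +-interchange _ _ _ _ ⟩
      (w + - w) + (t * z i + - (t * z j))  ≈⟨ +-cong (-‿inverseʳ w) (+-cong refl (-‿distribʳ-* _ _)) ⟩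
      0# + (t * z i + t * (- z j))         ≈⟨ trans (+-identityˡ _) (sym (distribˡ _ _ _)) ⟩
      t * (z i + - z j)                    ∎
    factor false i j = sym (*-identityʳ _)

module Determinants {c ℓ} (R : CommutativeRing c ℓ) where
  open BigOperators R public

  Mat : ℕ → Set c
  Mat n = Fin n → Fin n → Carrier

  minor : ∀ {n} → Mat (suc n) → Fin (suc n) → Mat n
  minor A j i k = A (fsuc i) (punchIn j k)

  laplaceTerm : ∀ n → Mat (suc n) → Fin (suc n) → Carrier
  laplaceTerm n A j = sign (toℕ j) * (A fzero j * det n (minor A j))

  det-cong : ∀ n {A B : Mat n} → (∀ i k → A i k ≈ B i k) → det n A ≈ det n B
  det-cong zero    eq = refl
  det-cong (suc n) {A} {B} eq = sumᶠ-cong (suc n) {laplaceTerm n A} {laplaceTerm n B} (λ j →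
    *-cong refl (*-cong (eq fzero j) (det-cong n (λ i k → eq (fsuc i) (punchIn j k)))))

  private
    punchIn-avoids : ∀ {n} (j : Fin (suc n)) {p} (j≢p : j ≢ p) k → k ≢ punchOut j≢p → punchIn j k ≢ p
    punchIn-avoids j j≢p k k≢p' e =
      k≢p' (punchIn-injective j k _ (≡.trans e (≡.sym (punchIn-punchOut j≢p))))

  det-additive : ∀ n (p : Fin n) (A B C : Mat n) →
    (∀ i k → k ≢ p → A i k ≈ C i k) → (∀ i k → k ≢ p → B i k ≈ C i k) →
    (∀ i → C i p ≈ A i p + B i p) → det n C ≈ det n A + det n B
  det-additive (suc n) p A B C eA eB eC =
    trans (sumᶠ-cong (suc n) {laplaceTerm n C} term) (sumᶠ-+ (suc n) (laplaceTerm n A) (laplaceTerm n B))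
    where
    term : ∀ j → laplaceTerm n C j ≈ laplaceTerm n A j + laplaceTerm n B j
    term j with j ≟ᶠ p
    ... | yes ≡.refl = trans (*-cong refl (*-cong (eC fzero) refl))
          (trans (trans (*-cong refl (distribʳ _ _ _)) (distribˡ _ _ _))
            (+-cong
              (*-cong refl (*-cong refl (det-cong n (λ i k → sym (eA _ _ (punchInᵢ≢i j k))))))
              (*-cong refl (*-cong refl (det-cong n (λ i k → sym (eB _ _ (punchInᵢ≢i j k))))))))
    ... | no j≢p = trans (*-cong refl (*-cong refl minor-additive))
          (trans (trans (*-cong refl (distribˡ _ _ _)) (distribˡ _ _ _))
            (+-cong (*-cong refl (*-cong (sym (eA fzero j j≢p)) refl))
                    (*-cong refl (*-cong (sym (eB fzero j j≢p)) refl))))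
      where
      minor-additive : det n (minor C j) ≈ det n (minor A j) + det n (minor B j)
      minor-additive = det-additive n (punchOut j≢p) (minor A j) (minor B j) (minor C j)
        (λ i k k≢ → eA (fsuc i) (punchIn j k) (punchIn-avoids j j≢p k k≢))
        (λ i k k≢ → eB (fsuc i) (punchIn j k) (punchIn-avoids j j≢p k k≢))
        (λ i → ≡.subst (λ z → C (fsuc i) z ≈ A (fsuc i) z + B (fsuc i) z)
                       (≡.sym (punchIn-punchOut j≢p)) (eC (fsuc i)))

  det-homogeneous : ∀ n (p : Fin n) (A C : Mat n) s →
    (∀ i k → k ≢ p → A i k ≈ C i k) → (∀ i → C i p ≈ s * A i p) → det n C ≈ s * det n A
  det-homogeneous (suc n) p A C s eA eC =
    trans (sumᶠ-cong (suc n) {laplaceTerm n C} term) (sym (*-distribˡ-sumᶠ (suc n) s (laplaceTerm n A)))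
    where
    term : ∀ j → laplaceTerm n C j ≈ s * laplaceTerm n A j
    term j with j ≟ᶠ p
    ... | yes ≡.refl = trans (*-cong refl (*-cong (eC fzero)
            (det-cong n (λ i k → sym (eA _ _ (punchInᵢ≢i j k))))))
          (trans (*-cong refl (*-assoc _ _ _)) (x*yz≈y*xz _ _ _))
    ... | no j≢p = trans (*-cong refl (*-cong (sym (eA fzero j j≢p)) minor-homogeneous))
          (trans (*-cong refl (x*yz≈y*xz _ _ _)) (x*yz≈y*xz _ _ _))
      where
      minor-homogeneous : det n (minor C j) ≈ s * det n (minor A j)
      minor-homogeneous = det-homogeneous n (punchOut j≢p) (minor A j) (minor C j) s
        (λ i k k≢ → eA (fsuc i) (punchIn j k) (punchIn-avoids j j≢p k k≢))
        (λ i → ≡.subst (λ z → C (fsuc i) z ≈ s * A (fsuc i) z)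
                       (≡.sym (punchIn-punchOut j≢p)) (eC (fsuc i)))

  punchIn-adjacent : ∀ {m} (k : Fin (suc (suc m))) (q : Fin (suc m)) → k ≢ inject₁ q → k ≢ fsuc q →
    Σ (Fin m) (λ q' → (punchIn k (inject₁ q') ≡ inject₁ q) × (punchIn k (fsuc q') ≡ fsuc q))
  punchIn-adjacent fzero fzero k≢q _ = contradiction ≡.refl k≢q
  punchIn-adjacent fzero (fsuc q') _ _ = q' , ≡.refl , ≡.refl
  punchIn-adjacent (fsuc fzero) fzero _ k≢q+1 = contradiction ≡.refl k≢q+1
  punchIn-adjacent {suc m} (fsuc (fsuc k)) fzero _ _ = fzero , ≡.refl , ≡.refl
  punchIn-adjacent {zero} (fsuc (fsuc ())) fzero _ _
  punchIn-adjacent {zero} (fsuc k) (fsuc ()) _ _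
  punchIn-adjacent {suc m} (fsuc k) (fsuc q)  k≢q k≢q+1
    with punchIn-adjacent k q (λ e → k≢q (≡.cong fsuc e)) (λ e → k≢q+1 (≡.cong fsuc e))
  ... | q' , e₁ , e₂ = fsuc q' , ≡.cong fsuc e₁ , ≡.cong fsuc e₂

  -- Deleting column q or column q+1 gives the same minor up to
  -- exchanging those two columns' contents.
  data AdjacentPunchIn {m} (q : Fin m) (x : Fin m) : Set where
    same    : punchIn (inject₁ q) x ≡ punchIn (fsuc q) x → AdjacentPunchIn q x
    swapped : punchIn (inject₁ q) x ≡ fsuc q → punchIn (fsuc q) x ≡ inject₁ q → AdjacentPunchIn q x

  adjacentPunchIn : ∀ {m} (q : Fin m) x → AdjacentPunchIn q x
  adjacentPunchIn fzero    fzero    = swapped ≡.refl ≡.refl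
  adjacentPunchIn fzero    (fsuc x) = same ≡.refl
  adjacentPunchIn (fsuc q) fzero    = same ≡.refl
  adjacentPunchIn (fsuc q) (fsuc x) with adjacentPunchIn q x
  ... | same e        = same (≡.cong fsuc e)
  ... | swapped e₁ e₂ = swapped (≡.cong fsuc e₁) (≡.cong fsuc e₂)

  sumᶠ-adjacentPair : ∀ m (q : Fin m) (T : Fin (suc m) → Carrier) →
    (∀ k → k ≢ inject₁ q → k ≢ fsuc q → T k ≈ 0#) → T (inject₁ q) + T (fsuc q) ≈ 0# →
    sumᶠ (suc m) T ≈ 0#
  sumᶠ-adjacentPair (suc m) fzero T others pair =
    trans (sym (+-assoc _ _ _))
      (trans (+-cong pair (sumᶠ-0 m _ (λ i → others (fsuc (fsuc i)) (λ ()) (λ ())))) (+-identityʳ 0#))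
  sumᶠ-adjacentPair (suc m) (fsuc q) T others pair =
    trans (+-cong (others fzero (λ ()) (λ ()))
                  (sumᶠ-adjacentPair m q (tail T)
                    (λ k k≢q k≢q+1 → others (fsuc k) (λ e → k≢q (Fin-suc-injective e))
                                                     (λ e → k≢q+1 (Fin-suc-injective e))) pair))
          (+-identityʳ 0#)
    where
    Fin-suc-injective : ∀ {n} {a b : Fin n} → fsuc a ≡ fsuc b → a ≡ b
    Fin-suc-injective ≡.refl = ≡.refl

  -- The two surviving Laplace terms cancel: their minors agree and their
  -- signs differ.
  det-adjacentEqual : ∀ m (q : Fin m) (A : Mat (suc m)) → (∀ i → A i (inject₁ q) ≈ A i (fsuc q)) →
    det (suc m) A ≈ 0#
  det-adjacentEqual (suc m) q A eq = sumᶠ-adjacentPair (suc m) q (laplaceTerm (suc m) A) others pair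
    where
    others : ∀ k → k ≢ inject₁ q → k ≢ fsuc q → laplaceTerm (suc m) A k ≈ 0#
    others k k≢q k≢q+1 with punchIn-adjacent k q k≢q k≢q+1
    ... | q' , e₁ , e₂ = trans (*-cong refl (*-cong refl
          (det-adjacentEqual m q' (minor A k) (λ i →
             ≡.subst₂ (λ z w → A (fsuc i) z ≈ A (fsuc i) w) (≡.sym e₁) (≡.sym e₂) (eq (fsuc i))))))
          (trans (*-cong refl (zeroʳ _)) (zeroʳ _))
    minors : ∀ i x → minor A (inject₁ q) i x ≈ minor A (fsuc q) i x
    minors i x with adjacentPunchIn q x
    ... | same e        = reflexive (≡.cong (A (fsuc i)) e)
    ... | swapped e₁ e₂ = ≡.subst₂ (λ z w → A (fsuc i) z ≈ A (fsuc i) w) (≡.sym e₁) (≡.sym e₂) (sym (eq (fsuc i)))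
    pair : laplaceTerm (suc m) A (inject₁ q) + laplaceTerm (suc m) A (fsuc q) ≈ 0#
    pair = trans (+-cong (*-cong (reflexive (≡.cong sign (toℕ-inject₁ q)))
                           (*-cong (eq fzero) (det-cong (suc m) minors)))
                         (sym (-‿distribˡ-* _ _)))
                 (-‿inverseʳ _)

module AlternatingForms {c ℓ} (R : CommutativeRing c ℓ) where
  open Determinants R public
  open import Data.Unit using (⊤)

  Col : ℕ → Set c
  Col N = Fin N → Carrier

  _+ᶜ_ : ∀ {N} → Col N → Col N → Col N
  (x +ᶜ y) i = x i + y i

  _·ᶜ_ : ∀ {N} → Carrier → Col N → Col N
  (s ·ᶜ x) i = s * x i

  VanishesOnAdjacentEqual : ∀ N m → ((Fin m → Col N) → Carrier) → Set (c ⊔ ℓ)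
  VanishesOnAdjacentEqual N zero    Φ = Lift (c ⊔ ℓ) ⊤
  VanishesOnAdjacentEqual N (suc m) Φ = ∀ (q : Fin m) (Q : Fin (suc m) → Col N) →
    (∀ i → Q (inject₁ q) i ≈ Q (fsuc q) i) → Φ Q ≈ 0#

  record AlternatingForm (N m : ℕ) : Set (c ⊔ ℓ) where
    field
      Φ           : (Fin m → Col N) → Carrier
      Φ-cong      : ∀ {Q Q' : Fin m → Col N} → (∀ k i → Q k i ≈ Q' k i) → Φ Q ≈ Φ Q'
      Φ-+         : ∀ Q p (x y : Col N) → Φ (Q [ p ]≔ (x +ᶜ y)) ≈ Φ (Q [ p ]≔ x) + Φ (Q [ p ]≔ y)
      Φ-·         : ∀ Q p s (x : Col N) → Φ (Q [ p ]≔ (s ·ᶜ x)) ≈ s * Φ (Q [ p ]≔ x)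
      Φ-adjacent  : VanishesOnAdjacentEqual N m Φ
  open AlternatingForm public

  ∷-cong : ∀ {N m} (x : Col N) {Q Q' : Fin m → Col N} → (∀ k i → Q k i ≈ Q' k i) →
    ∀ k i → (x ∷ Q) k i ≈ (x ∷ Q') k i
  ∷-cong x e fzero    i = refl
  ∷-cong x e (fsuc k) i = e k i

  fixFirst : ∀ {N m} → AlternatingForm N (suc m) → Col N → AlternatingForm N m
  fixFirst {N} {m} F x = record
    { Φ          = λ Q → Φ F (x ∷ Q)
    ; Φ-cong     = λ e → Φ-cong F (∷-cong x e)
    ; Φ-+        = λ Q p y z → Φ-+ F (x ∷ Q) (fsuc p) y z
    ; Φ-·        = λ Q p s y → Φ-· F (x ∷ Q) (fsuc p) s y
    ; Φ-adjacent = adjacent m (Φ F) (Φ-adjacent F) }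
    where
    adjacent : ∀ m (Ψ : (Fin (suc m) → Col N) → Carrier) → VanishesOnAdjacentEqual N (suc m) Ψ →
      VanishesOnAdjacentEqual N m (λ Q → Ψ (x ∷ Q))
    adjacent zero    Ψ _ = lift tt
    adjacent (suc m) Ψ a = λ q Q e → a (fsuc q) (x ∷ Q) e

  []≔-self : ∀ {N m} (Q : Fin m → Col N) p (w : Col N) → (∀ i → w i ≈ Q p i) →
    ∀ k i → (Q [ p ]≔ w) k i ≈ Q k i
  []≔-self Q fzero    w e fzero    i = e i
  []≔-self Q fzero    w e (fsuc k) i = refl
  []≔-self Q (fsuc p) w e fzero    i = refl
  []≔-self Q (fsuc p) w e (fsuc k) i = []≔-self (tail Q) p w e k i

  detForm : ∀ N → AlternatingForm N N
  detForm N = record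
    { Φ          = λ Q → det N (λ i k → Q k i)
    ; Φ-cong     = λ e → det-cong N (λ i k → e k i)
    ; Φ-+        = λ Q p x y → det-additive N p _ _ _
        (elsewhere Q p x (x +ᶜ y)) (elsewhere Q p y (x +ᶜ y))
        (λ i → reflexive (≡.trans (at Q p (x +ᶜ y) i)
                                  (≡.cong₂ _+_ (≡.sym (at Q p x i)) (≡.sym (at Q p y i)))))
    ; Φ-·        = λ Q p s x → det-homogeneous N p _ _ s
        (elsewhere Q p x (s ·ᶜ x))
        (λ i → reflexive (≡.trans (at Q p (s ·ᶜ x) i) (≡.cong (s *_) (≡.sym (at Q p x i)))))
    ; Φ-adjacent = adjacent N }
    where
    at : ∀ (Q : Fin N → Col N) p x i → (Q [ p ]≔ x) p i ≡ x i
    at Q p x i = ≡.cong (λ f → f i) ([]≔-updates Q p x)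
    elsewhere : ∀ (Q : Fin N → Col N) p x y i k → k ≢ p → (Q [ p ]≔ x) k i ≈ (Q [ p ]≔ y) k i
    elsewhere Q p x y i k k≢p = reflexive (≡.trans (≡.cong (λ f → f i) ([]≔-minimal Q p x k k≢p))
                                                   (≡.sym (≡.cong (λ f → f i) ([]≔-minimal Q p y k k≢p))))
    adjacent : ∀ N → VanishesOnAdjacentEqual N N (λ Q → det N (λ i k → Q k i))
    adjacent zero    = lift tt
    adjacent (suc m) = λ q Q e → det-adjacentEqual m q (λ i k → Q k i) e

  module _ {N : ℕ} where

    Φ-zeroColumn : ∀ {m} (F : AlternatingForm N m) Q p → (∀ i → Q p i ≈ 0#) → Φ F Q ≈ 0#
    Φ-zeroColumn F Q p e = begin
      Φ F Q                          ≈⟨ Φ-cong F (λ k i → sym ([]≔-self Q p (0# ·ᶜ Q p) (λ i → trans (zeroˡ _) (sym (e i))) k i)) ⟩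
      Φ F (Q [ p ]≔ (0# ·ᶜ Q p))     ≈⟨ Φ-· F Q p 0# (Q p) ⟩
      0# * Φ F (Q [ p ]≔ Q p)        ≈⟨ zeroˡ _ ⟩
      0#                             ∎

    Φ-linearCombination : ∀ {m} (F : AlternatingForm N m) Q p L (b : Fin L → Carrier) (a : Fin L → Col N) →
      Φ F (Q [ p ]≔ (λ i → sumᶠ L (λ l → b l * a l i))) ≈ sumᶠ L (λ l → b l * Φ F (Q [ p ]≔ a l))
    Φ-linearCombination F Q p zero    b a =
      Φ-zeroColumn F _ p (λ i → reflexive (≡.cong (λ f → f i) ([]≔-updates Q p _)))
    Φ-linearCombination F Q p (suc L) b a = begin
      Φ F (Q [ p ]≔ ((b fzero ·ᶜ a fzero) +ᶜ (λ i → sumᶠ L (λ l → b (fsuc l) * a (fsuc l) i))))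
        ≈⟨ Φ-+ F Q p _ _ ⟩
      Φ F (Q [ p ]≔ (b fzero ·ᶜ a fzero)) + Φ F (Q [ p ]≔ (λ i → sumᶠ L (λ l → b (fsuc l) * a (fsuc l) i)))
        ≈⟨ +-cong (Φ-· F Q p _ _) (Φ-linearCombination F Q p L (tail b) (tail a)) ⟩
      sumᶠ (suc L) (λ l → b l * Φ F (Q [ p ]≔ a l)) ∎

    Φ-swap : ∀ {m} (F : AlternatingForm N (suc (suc m))) x y Q →
      Φ F (y ∷ x ∷ Q) ≈ - Φ F (x ∷ y ∷ Q)
    Φ-swap F x y Q = +-inverseʳ-unique _ _ (begin
      Φ F (x ∷ y ∷ Q) + Φ F (y ∷ x ∷ Q)
        ≈⟨ sym (+-cong (+-identityˡ _) (+-identityʳ _)) ⟩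
      (0# + Φ F (x ∷ y ∷ Q)) + (Φ F (y ∷ x ∷ Q) + 0#)
        ≈⟨ sym (+-cong (+-cong (Φ-adjacent F fzero (x ∷ x ∷ Q) (λ i → refl)) refl)
                       (+-cong refl (Φ-adjacent F fzero (y ∷ y ∷ Q) (λ i → refl)))) ⟩
      (Φ F (x ∷ x ∷ Q) + Φ F (x ∷ y ∷ Q)) + (Φ F (y ∷ x ∷ Q) + Φ F (y ∷ y ∷ Q))
        ≈⟨ sym (+-cong (Φ-+ F (x ∷ (x +ᶜ y) ∷ Q) (fsuc fzero) x y)
                       (Φ-+ F (y ∷ (x +ᶜ y) ∷ Q) (fsuc fzero) x y)) ⟩
      Φ F (x ∷ (x +ᶜ y) ∷ Q) + Φ F (y ∷ (x +ᶜ y) ∷ Q)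
        ≈⟨ sym (Φ-+ F ((x +ᶜ y) ∷ (x +ᶜ y) ∷ Q) fzero x y) ⟩
      Φ F ((x +ᶜ y) ∷ (x +ᶜ y) ∷ Q)
        ≈⟨ Φ-adjacent F fzero _ (λ i → refl) ⟩
      0# ∎)

    Φ-moveToFront : ∀ m (F : AlternatingForm N (suc m)) (p : Fin (suc m)) Q →
      Φ F Q ≈ sign (toℕ p) * Φ F (Q p ∷ (λ k → Q (punchIn p k)))
    Φ-moveToFront m F fzero Q = trans (Φ-cong F (λ { fzero i → refl ; (fsuc k) i → refl })) (sym (*-identityˡ _))
    Φ-moveToFront (suc m) F (fsuc p) Q = begin
      Φ F Q
        ≈⟨ Φ-cong F (λ { fzero i → refl ; (fsuc k) i → refl }) ⟩
      Φ (fixFirst F (Q fzero)) (tail Q)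
        ≈⟨ Φ-moveToFront m (fixFirst F (Q fzero)) p (tail Q) ⟩
      sign (toℕ p) * Φ F (Q fzero ∷ Q (fsuc p) ∷ Q')
        ≈⟨ *-cong refl (Φ-swap F _ _ _) ⟩
      sign (toℕ p) * - Φ F (Q (fsuc p) ∷ Q fzero ∷ Q')
        ≈⟨ trans (sym (-‿distribʳ-* _ _)) (-‿distribˡ-* _ _) ⟩
      sign (toℕ (fsuc p)) * Φ F (Q (fsuc p) ∷ Q fzero ∷ Q')
        ≈⟨ *-cong refl (Φ-cong F (λ { fzero i → refl ; (fsuc fzero) i → refl ; (fsuc (fsuc k)) i → refl })) ⟩
      sign (toℕ (fsuc p)) * Φ F (Q (fsuc p) ∷ (λ k → Q (punchIn (fsuc p) k))) ∎
      where
      Q' = λ k → Q (fsuc (punchIn p k))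

    Φ-repeated : ∀ m (F : AlternatingForm N (suc m)) x (Q : Fin m → Col N) p → (∀ i → Q p i ≈ x i) →
      Φ F (x ∷ Q) ≈ 0#
    Φ-repeated (suc m) F x Q p e = begin
      Φ (fixFirst F x) Q
        ≈⟨ Φ-moveToFront m (fixFirst F x) p Q ⟩
      sign (toℕ p) * Φ F (x ∷ Q p ∷ (λ k → Q (punchIn p k)))
        ≈⟨ *-cong refl (Φ-adjacent F fzero _ (λ i → sym (e i))) ⟩
      sign (toℕ p) * 0#
        ≈⟨ zeroʳ _ ⟩
      0# ∎

    -- Every term of the expansion that uses x twice vanishes.
    Φ-rankOneUpdate : ∀ m (F : AlternatingForm N m) (b : Fin m → Carrier) (x : Col N) (Q : Fin m → Col N) →
      Φ F (λ k → (b k ·ᶜ x) +ᶜ Q k) ≈ Φ F Q + sumᶠ m (λ k → b k * Φ F (Q [ k ]≔ x))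
    Φ-rankOneUpdate zero    F b x Q = trans (Φ-cong F (λ ())) (sym (+-identityʳ _))
    Φ-rankOneUpdate (suc m) F b x Q = begin
      Φ F Q'
        ≈⟨ Φ-cong F (λ { fzero i → refl ; (fsuc k) i → refl }) ⟩
      Φ F (Q' [ fzero ]≔ ((b fzero ·ᶜ x) +ᶜ Q fzero))
        ≈⟨ Φ-+ F Q' fzero _ _ ⟩
      Φ F (Q' [ fzero ]≔ (b fzero ·ᶜ x)) + Φ F (Q' [ fzero ]≔ Q fzero)
        ≈⟨ +-cong (Φ-· F Q' fzero (b fzero) x) refl ⟩
      b fzero * Φ (fixFirst F x) (tail Q') + Φ (fixFirst F (Q fzero)) (tail Q')
        ≈⟨ +-cong (*-cong refl first-x) (Φ-rankOneUpdate m (fixFirst F (Q fzero)) (tail b) x (tail Q)) ⟩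
      b fzero * Φ F (Q [ fzero ]≔ x) + (Φ F (Q fzero ∷ tail Q) + sumᶠ m (λ k → b (fsuc k) * Φ F (Q [ fsuc k ]≔ x)))
        ≈⟨ x+yz≈y+xz _ _ _ ⟩
      Φ F (Q fzero ∷ tail Q) + (b fzero * Φ F (Q [ fzero ]≔ x) + sumᶠ m (λ k → b (fsuc k) * Φ F (Q [ fsuc k ]≔ x)))
        ≈⟨ +-cong (Φ-cong F (λ { fzero i → refl ; (fsuc k) i → refl })) refl ⟩
      Φ F Q + sumᶠ (suc m) (λ k → b k * Φ F (Q [ k ]≔ x)) ∎
      where
      Q' : Fin (suc m) → Col N
      Q' k = (b k ·ᶜ x) +ᶜ Q k
      first-x : Φ (fixFirst F x) (tail Q') ≈ Φ F (Q [ fzero ]≔ x)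
      first-x = begin
        Φ (fixFirst F x) (tail Q')
          ≈⟨ Φ-rankOneUpdate m (fixFirst F x) (tail b) x (tail Q) ⟩
        Φ F (x ∷ tail Q) + sumᶠ m (λ k → b (fsuc k) * Φ F (x ∷ (tail Q [ k ]≔ x)))
          ≈⟨ +-cong refl (sumᶠ-0 m _ (λ k → trans (*-cong refl
               (Φ-repeated m F x (tail Q [ k ]≔ x) k (λ i → reflexive (≡.cong (λ f → f i) ([]≔-updates _ k x))))) (zeroʳ _))) ⟩
        Φ F (x ∷ tail Q) + 0#
          ≈⟨ +-identityʳ _ ⟩
        Φ F (Q [ fzero ]≔ x) ∎

module CauchyBinet {c ℓ} (R : CommutativeRing c ℓ) where
  open AlternatingForms R public

  -- Sum over the strictly increasing maps Fin n → Fin L, i.e. over the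
  -- n-element subsets of Fin L.
  sumSubsets : ∀ n L → ((Fin n → Fin L) → Carrier) → Carrier
  sumSubsets zero    L       f = f (λ ())
  sumSubsets (suc n) zero    f = 0#
  sumSubsets (suc n) (suc L) f = sumSubsets (suc n) L (λ g → f (λ k → fsuc (g k)))
                               + sumSubsets n L (λ g → f (fzero ∷ (λ k → fsuc (g k))))

  sumSubsets-cong : ∀ n L {f f' : (Fin n → Fin L) → Carrier} → (∀ g → f g ≈ f' g) →
    sumSubsets n L f ≈ sumSubsets n L f'
  sumSubsets-cong zero    L       e = e _
  sumSubsets-cong (suc n) zero    e = refl
  sumSubsets-cong (suc n) (suc L) e = +-cong (sumSubsets-cong (suc n) L (λ g → e _)) (sumSubsets-cong n L (λ g → e _))

  *-distribˡ-sumSubsets : ∀ n L x (f : (Fin n → Fin L) → Carrier) →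
    x * sumSubsets n L f ≈ sumSubsets n L (λ g → x * f g)
  *-distribˡ-sumSubsets zero    L       x f = refl
  *-distribˡ-sumSubsets (suc n) zero    x f = zeroʳ x
  *-distribˡ-sumSubsets (suc n) (suc L) x f =
    trans (distribˡ x _ _) (+-cong (*-distribˡ-sumSubsets (suc n) L x _) (*-distribˡ-sumSubsets n L x _))

  sumSubsets-+ : ∀ n L (f f' : (Fin n → Fin L) → Carrier) →
    sumSubsets n L (λ g → f g + f' g) ≈ sumSubsets n L f + sumSubsets n L f'
  sumSubsets-+ zero    L       f f' = refl
  sumSubsets-+ (suc n) zero    f f' = sym (+-identityʳ 0#)
  sumSubsets-+ (suc n) (suc L) f f' =
    trans (+-cong (sumSubsets-+ (suc n) L _ _) (sumSubsets-+ n L _ _)) (+-interchange _ _ _ _)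

  sumSubsets-0 : ∀ n L (f : (Fin n → Fin L) → Carrier) → (∀ g → f g ≈ 0#) → sumSubsets n L f ≈ 0#
  sumSubsets-0 zero    L       f e = e _
  sumSubsets-0 (suc n) zero    f e = refl
  sumSubsets-0 (suc n) (suc L) f e =
    trans (+-cong (sumSubsets-0 (suc n) L _ (λ g → e _)) (sumSubsets-0 n L _ (λ g → e _))) (+-identityʳ 0#)

  sumᶠ-sumSubsets : ∀ n L m (f : Fin m → (Fin n → Fin L) → Carrier) →
    sumᶠ m (λ k → sumSubsets n L (f k)) ≈ sumSubsets n L (λ g → sumᶠ m (λ k → f k g))
  sumᶠ-sumSubsets n L zero    f = sym (sumSubsets-0 n L _ (λ g → refl))
  sumᶠ-sumSubsets n L (suc m) f =
    trans (+-cong refl (sumᶠ-sumSubsets n L m (tail f))) (sym (sumSubsets-+ n L _ _))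

  sumSubsets-tooLarge : ∀ L n (f : (Fin n → Fin L) → Carrier) → L < n → sumSubsets n L f ≈ 0#
  sumSubsets-tooLarge zero    (suc n) f _ = refl
  sumSubsets-tooLarge (suc L) (suc n) f (s≤s L<n) =
    trans (+-cong (sumSubsets-tooLarge L (suc n) _ (ℕ.m<n⇒m<1+n L<n)) (sumSubsets-tooLarge L n _ L<n))
          (+-identityʳ 0#)

  Extensional : ∀ {n L} → ((Fin n → Fin L) → Carrier) → Set ℓ
  Extensional {n} {L} f = ∀ (g g' : Fin n → Fin L) → (∀ k → g k ≡ g' k) → f g ≈ f g'

  sumSubsets-all : ∀ n (f : (Fin n → Fin n) → Carrier) → Extensional f → sumSubsets n n f ≈ f (λ k → k)
  sumSubsets-all zero    f ext = ext _ _ (λ ())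
  sumSubsets-all (suc n) f ext =
    trans (+-cong (sumSubsets-tooLarge n (suc n) _ ℕ.≤-refl)
                  (sumSubsets-all n (λ g → f (fzero ∷ (λ k → fsuc (g k))))
                     (λ g g' e → ext _ _ (λ { fzero → ≡.refl ; (fsuc k) → ≡.cong fsuc (e k) }))))
          (trans (+-identityˡ _) (ext _ _ (λ { fzero → ≡.refl ; (fsuc k) → ≡.refl })))

  sumSubsets-allButOne : ∀ n (f : (Fin n → Fin (suc n)) → Carrier) → Extensional f →
    sumSubsets n (suc n) f ≈ sumᶠ (suc n) (λ r → f (punchIn r))
  sumSubsets-allButOne zero    f ext = trans (ext _ _ (λ ())) (sym (+-identityʳ _))
  sumSubsets-allButOne (suc n) f ext = +-cong
    (trans (sumSubsets-all (suc n) _ (λ g g' e → ext _ _ (λ k → ≡.cong fsuc (e k)))) (ext _ _ (λ k → ≡.refl)))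
    (trans (sumSubsets-allButOne n (λ g → f (fzero ∷ (λ k → fsuc (g k))))
              (λ g g' e → ext _ _ (λ { fzero → ≡.refl ; (fsuc k) → ≡.cong fsuc (e k) })))
           (sumᶠ-cong (suc n) {λ r → f (fzero ∷ (λ k → fsuc (punchIn r k)))} (λ r → ext _ (punchIn (fsuc r)) (λ { fzero → ≡.refl ; (fsuc k) → ≡.refl }))))

  module _ {N : ℕ} where

    cauchyBinet : ∀ L m (F : AlternatingForm N m) (a : Fin L → Col N) (b : Fin L → Fin m → Carrier) →
      Φ F (λ k i → sumᶠ L (λ l → b l k * a l i)) ≈
      sumSubsets m L (λ g → Φ F (λ k → a (g k)) * det m (λ r k → b (g r) k))
    cauchyBinet L       zero    F a b = trans (Φ-cong F (λ ())) (sym (*-identityʳ _))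
    cauchyBinet zero    (suc m) F a b = Φ-zeroColumn F _ fzero (λ i → refl)
    cauchyBinet (suc L) (suc m) F a b = begin
      Φ F (λ k → (b fzero k ·ᶜ a fzero) +ᶜ Q k)
        ≈⟨ Φ-rankOneUpdate (suc m) F (b fzero) (a fzero) Q ⟩
      Φ F Q + sumᶠ (suc m) (λ k → b fzero k * Φ F (Q [ k ]≔ a fzero))
        ≈⟨ +-cong (cauchyBinet L (suc m) F (tail a) (tail b)) through-a₀ ⟩
      sumSubsets (suc m) L (λ g → Φ F (λ k → a (fsuc (g k))) * det (suc m) (λ r k → b (fsuc (g r)) k))
        + sumSubsets m L (λ g → Φ F (λ k → a (g₀ g k)) * det (suc m) (λ r k → b (g₀ g r) k)) ∎
      where
      Q : Fin (suc m) → Col N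
      Q k i = sumᶠ L (λ l → b (fsuc l) k * a (fsuc l) i)
      g₀ : (Fin m → Fin L) → Fin (suc m) → Fin (suc L)
      g₀ g = fzero ∷ (λ k → fsuc (g k))
      X : (Fin m → Fin L) → Carrier
      X g = Φ F (a fzero ∷ (λ k → a (fsuc (g k))))
      Y : Fin (suc m) → (Fin m → Fin L) → Carrier
      Y k g = det m (λ r k' → b (fsuc (g r)) (punchIn k k'))
      column-k : ∀ k → Φ F (Q [ k ]≔ a fzero) ≈ sign (toℕ k) * sumSubsets m L (λ g → X g * Y k g)
      column-k k = begin
        Φ F (Q [ k ]≔ a fzero)
          ≈⟨ Φ-moveToFront m F k _ ⟩
        sign (toℕ k) * Φ F ((Q [ k ]≔ a fzero) k ∷ (λ k' → (Q [ k ]≔ a fzero) (punchIn k k')))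
          ≈⟨ *-cong refl (Φ-cong F moved) ⟩
        sign (toℕ k) * Φ (fixFirst F (a fzero)) (λ k' i → sumᶠ L (λ l → b (fsuc l) (punchIn k k') * a (fsuc l) i))
          ≈⟨ *-cong refl (cauchyBinet L m (fixFirst F (a fzero)) (tail a) (λ l k' → b (fsuc l) (punchIn k k'))) ⟩
        sign (toℕ k) * sumSubsets m L (λ g → X g * Y k g) ∎
        where
        moved : ∀ k'' i → ((Q [ k ]≔ a fzero) k ∷ (λ k' → (Q [ k ]≔ a fzero) (punchIn k k'))) k'' i
                        ≈ (a fzero ∷ (λ k' → Q (punchIn k k'))) k'' i
        moved fzero     i = reflexive (≡.cong (λ f → f i) ([]≔-updates Q k (a fzero)))
        moved (fsuc k') i = reflexive (≡.cong (λ f → f i) ([]≔-minimal Q k (a fzero) (punchIn k k') (punchInᵢ≢i k k')))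
      through-a₀ : sumᶠ (suc m) (λ k → b fzero k * Φ F (Q [ k ]≔ a fzero)) ≈
        sumSubsets m L (λ g → Φ F (λ k → a (g₀ g k)) * det (suc m) (λ r k → b (g₀ g r) k))
      through-a₀ = begin
        sumᶠ (suc m) (λ k → b fzero k * Φ F (Q [ k ]≔ a fzero))
          ≈⟨ sumᶠ-cong (suc m) {λ k → b fzero k * Φ F (Q [ k ]≔ a fzero)} (λ k → trans (*-cong refl (column-k k))
               (trans (*-cong refl (*-distribˡ-sumSubsets m L _ _)) (*-distribˡ-sumSubsets m L _ _))) ⟩
        sumᶠ (suc m) (λ k → sumSubsets m L (λ g → b fzero k * (sign (toℕ k) * (X g * Y k g))))
          ≈⟨ sumᶠ-sumSubsets m L (suc m) (λ k g → b fzero k * (sign (toℕ k) * (X g * Y k g))) ⟩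
        sumSubsets m L (λ g → sumᶠ (suc m) (λ k → b fzero k * (sign (toℕ k) * (X g * Y k g))))
          ≈⟨ sumSubsets-cong m L (λ g → trans
               (sumᶠ-cong (suc m) {λ k → b fzero k * (sign (toℕ k) * (X g * Y k g))} (λ k → solve 4 (λ b s x y → (b ⊗ (s ⊗ (x ⊗ y))) ⊜ (x ⊗ (s ⊗ (b ⊗ y)))) refl _ _ _ _))
               (sym (*-distribˡ-sumᶠ (suc m) (X g) (λ k → sign (toℕ k) * (b fzero k * Y k g))))) ⟩
        sumSubsets m L (λ g → X g * det (suc m) (λ r k → b (g₀ g r) k))
          ≈⟨ sumSubsets-cong m L (λ g → *-cong (Φ-cong F (λ { fzero i → refl ; (fsuc k) i → refl })) refl) ⟩
        sumSubsets m L (λ g → Φ F (λ k → a (g₀ g k)) * det (suc m) (λ r k → b (g₀ g r) k)) ∎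

module DeterminantIdentities {c ℓ} (R : CommutativeRing c ℓ) where
  open CauchyBinet R public

  unitCol : ∀ {n} → Fin n → Col n
  unitCol fzero    fzero    = 1#
  unitCol fzero    (fsuc i) = 0#
  unitCol (fsuc l) fzero    = 0#
  unitCol (fsuc l) (fsuc i) = unitCol l i

  sumᶠ-unitCol : ∀ n (x : Fin n → Carrier) i → sumᶠ n (λ l → x l * unitCol l i) ≈ x i
  sumᶠ-unitCol (suc n) x fzero    = trans (+-cong (*-identityʳ _) (sumᶠ-0 n _ (λ l → zeroʳ _))) (+-identityʳ _)
  sumᶠ-unitCol (suc n) x (fsuc i) = trans (+-cong (zeroʳ _) (sumᶠ-unitCol n (tail x) i)) (+-identityˡ _)

  det-unitFirstColumn : ∀ n (l : Fin (suc n)) (A : Mat (suc n)) → (∀ i → A i fzero ≈ unitCol l i) →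
    det (suc n) A ≈ sign (toℕ l) * det n (λ i k → A (punchIn l i) (fsuc k))
  det-unitFirstColumn n fzero A e = begin
    sumᶠ (suc n) (laplaceTerm n A)
      ≈⟨ +-cong refl (sumᶠ-0 n _ (λ k → trans (*-cong refl (*-cong refl (minor-vanishes A (λ i → e (fsuc i)) k)))
                                             (trans (*-cong refl (zeroʳ _)) (zeroʳ _)))) ⟩
    laplaceTerm n A fzero + 0#
      ≈⟨ +-identityʳ _ ⟩
    1# * (A fzero fzero * det n (minor A fzero))
      ≈⟨ *-cong refl (trans (*-cong (e fzero) refl) (*-identityˡ _)) ⟩
    sign 0 * det n (λ i k → A (punchIn fzero i) (fsuc k)) ∎
    where
    minor-vanishes : ∀ {n} (A : Mat (suc n)) → (∀ i → A (fsuc i) fzero ≈ 0#) → ∀ k → det n (minor A (fsuc k)) ≈ 0#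
    minor-vanishes {suc n} A e k = Φ-zeroColumn (detForm (suc n)) (λ k' i → minor A (fsuc k) i k') fzero e
  det-unitFirstColumn (suc n) (fsuc l) A e = begin
    sumᶠ (suc (suc n)) (laplaceTerm (suc n) A)
      ≈⟨ +-cong (trans (*-cong refl (*-cong (e fzero) refl)) (trans (*-cong refl (zeroˡ _)) (zeroʳ _))) refl ⟩
    0# + sumᶠ (suc n) (λ k → laplaceTerm (suc n) A (fsuc k))
      ≈⟨ +-identityˡ _ ⟩
    sumᶠ (suc n) (λ k → laplaceTerm (suc n) A (fsuc k))
      ≈⟨ sumᶠ-cong (suc n) {λ k → laplaceTerm (suc n) A (fsuc k)} term ⟩
    sumᶠ (suc n) (λ k → (- sign (toℕ l)) * (sign (toℕ k) * (A fzero (fsuc k) * D k)))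
      ≈⟨ sym (*-distribˡ-sumᶠ (suc n) (- sign (toℕ l)) (λ k → sign (toℕ k) * (A fzero (fsuc k) * D k))) ⟩
    sign (toℕ (fsuc l)) * det (suc n) (λ i k → A (punchIn (fsuc l) i) (fsuc k)) ∎
    where
    D : Fin (suc n) → Carrier
    D k = det n (λ i k' → A (fsuc (punchIn l i)) (fsuc (punchIn k k')))
    term : ∀ k → laplaceTerm (suc n) A (fsuc k) ≈ (- sign (toℕ l)) * (sign (toℕ k) * (A fzero (fsuc k) * D k))
    term k = begin
      (- sign (toℕ k)) * (A fzero (fsuc k) * det (suc n) (minor A (fsuc k)))
        ≈⟨ *-cong refl (*-cong refl (det-unitFirstColumn n l (minor A (fsuc k)) (λ i → e (fsuc i)))) ⟩
      (- sign (toℕ k)) * (A fzero (fsuc k) * (sign (toℕ l) * D k))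
        ≈⟨ sym (-‿distribˡ-* _ _) ⟩
      - (sign (toℕ k) * (A fzero (fsuc k) * (sign (toℕ l) * D k)))
        ≈⟨ -‿cong (solve 4 (λ s a t d → (s ⊗ (a ⊗ (t ⊗ d))) ⊜ (t ⊗ (s ⊗ (a ⊗ d)))) refl _ _ _ _) ⟩
      - (sign (toℕ l) * (sign (toℕ k) * (A fzero (fsuc k) * D k)))
        ≈⟨ -‿distribˡ-* _ _ ⟩
      (- sign (toℕ l)) * (sign (toℕ k) * (A fzero (fsuc k) * D k)) ∎

  -- Write the first column as Σ_l A l 0 · e_l and use linearity.
  det-expandFirstColumn : ∀ n (A : Mat (suc n)) →
    det (suc n) A ≈ sumᶠ (suc n) (λ l → sign (toℕ l) * (A l fzero * det n (λ i k → A (punchIn l i) (fsuc k))))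
  det-expandFirstColumn n A = begin
    det (suc n) A
      ≈⟨ Φ-cong (detForm (suc n)) first-column ⟩
    Φ (detForm (suc n)) (Aᵀ [ fzero ]≔ (λ i → sumᶠ (suc n) (λ l → A l fzero * unitCol l i)))
      ≈⟨ Φ-linearCombination (detForm (suc n)) Aᵀ fzero (suc n) (λ l → A l fzero) unitCol ⟩
    sumᶠ (suc n) (λ l → A l fzero * det (suc n) (λ i k → (Aᵀ [ fzero ]≔ unitCol l) k i))
      ≈⟨ sumᶠ-cong (suc n) {λ l → A l fzero * det (suc n) (λ i k → (Aᵀ [ fzero ]≔ unitCol l) k i)}
           (λ l → *-cong refl (det-unitFirstColumn n l (λ i k → (Aᵀ [ fzero ]≔ unitCol l) k i) (λ i → refl))) ⟩
    sumᶠ (suc n) (λ l → A l fzero * (sign (toℕ l) * det n (λ i k → A (punchIn l i) (fsuc k))))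
      ≈⟨ sumᶠ-cong (suc n) {λ l → A l fzero * (sign (toℕ l) * det n (λ i k → A (punchIn l i) (fsuc k)))}
           (λ l → x*yz≈y*xz _ _ _) ⟩
    sumᶠ (suc n) (λ l → sign (toℕ l) * (A l fzero * det n (λ i k → A (punchIn l i) (fsuc k)))) ∎
    where
    Aᵀ : Fin (suc n) → Col (suc n)
    Aᵀ k i = A i k
    first-column : ∀ k i → A i k ≈ (Aᵀ [ fzero ]≔ (λ i → sumᶠ (suc n) (λ l → A l fzero * unitCol l i))) k i
    first-column fzero    i = sym (sumᶠ-unitCol (suc n) (λ l → A l fzero) i)
    first-column (fsuc k) i = refl

  det-transpose : ∀ n (A : Mat n) → det n (λ i k → A k i) ≈ det n A
  det-transpose zero    A = refl
  det-transpose (suc n) A = trans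
    (sumᶠ-cong (suc n) {laplaceTerm n (λ i k → A k i)}
      (λ l → *-cong refl (*-cong refl (det-transpose n (λ i k → A (punchIn l i) (fsuc k))))))
    (sym (det-expandFirstColumn n A))

  det-scaleRows : ∀ n (s : Fin n → Carrier) (A : Mat n) → det n (λ i k → s i * A i k) ≈ prodᶠ n s * det n A
  det-scaleRows zero    s A = sym (*-identityʳ 1#)
  det-scaleRows (suc n) s A = trans
    (sumᶠ-cong (suc n) {laplaceTerm n (λ i k → s i * A i k)} term)
    (sym (*-distribˡ-sumᶠ (suc n) _ (laplaceTerm n A)))
    where
    term : ∀ k → laplaceTerm n (λ i k → s i * A i k) k ≈ (s fzero * prodᶠ n (tail s)) * laplaceTerm n A k
    term k = trans (*-cong refl (*-cong refl (det-scaleRows n (tail s) (minor A k))))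
      (trans (*-cong refl (*-interchange _ _ _ _)) (x*yz≈y*xz _ _ _))

  addNextColumn : ∀ {N} m → Carrier → (Fin (suc m) → Col N) → Fin (suc m) → Col N
  addNextColumn zero    t Q = Q
  addNextColumn (suc m) t Q = (Q fzero +ᶜ (t ·ᶜ Q (fsuc fzero))) ∷ addNextColumn m t (tail Q)

  Φ-addNextColumn : ∀ {N} m (F : AlternatingForm N (suc m)) t Q → Φ F (addNextColumn m t Q) ≈ Φ F Q
  Φ-addNextColumn zero    F t Q = refl
  Φ-addNextColumn (suc m) F t Q = begin
    Φ (fixFirst F (Q fzero +ᶜ (t ·ᶜ Q (fsuc fzero)))) (addNextColumn m t (tail Q))
      ≈⟨ Φ-addNextColumn m (fixFirst F _) t (tail Q) ⟩
    Φ F (Q [ fzero ]≔ (Q fzero +ᶜ (t ·ᶜ Q (fsuc fzero))))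
      ≈⟨ Φ-+ F Q fzero _ _ ⟩
    Φ F (Q [ fzero ]≔ Q fzero) + Φ F (Q [ fzero ]≔ (t ·ᶜ Q (fsuc fzero)))
      ≈⟨ +-cong (Φ-cong F ([]≔-self Q fzero (Q fzero) (λ i → refl))) (Φ-· F Q fzero t _) ⟩
    Φ F Q + t * Φ F (Q [ fzero ]≔ Q (fsuc fzero))
      ≈⟨ +-cong refl (*-cong refl (Φ-adjacent F fzero _ (λ i → refl))) ⟩
    Φ F Q + t * 0#
      ≈⟨ trans (+-cong refl (zeroʳ t)) (+-identityʳ _) ⟩
    Φ F Q ∎

  addNextColumn-inject₁ : ∀ {N} m t (Q : Fin (suc m) → Col N) (q : Fin m) i →
    addNextColumn m t Q (inject₁ q) i ≡ Q (inject₁ q) i + t * Q (fsuc q) i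
  addNextColumn-inject₁ (suc m) t Q fzero    i = ≡.refl
  addNextColumn-inject₁ (suc m) t Q (fsuc q) i = addNextColumn-inject₁ m t (tail Q) q i

  addNextColumn-last : ∀ {N} m t (Q : Fin (suc m) → Col N) i → addNextColumn m t Q (fromℕ m) i ≡ Q (fromℕ m) i
  addNextColumn-last zero    t Q i = ≡.refl
  addNextColumn-last (suc m) t Q i = addNextColumn-last m t (tail Q) i

  punchIn-fromℕ : ∀ m (k : Fin m) → punchIn (fromℕ m) k ≡ inject₁ k
  punchIn-fromℕ (suc m) fzero    = ≡.refl
  punchIn-fromℕ (suc m) (fsuc k) = ≡.cong fsuc (punchIn-fromℕ m k)

  det-firstRowLast : ∀ m (A : Mat (suc m)) → (∀ q → A fzero (inject₁ q) ≈ 0#) →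
    det (suc m) A ≈ sign m * (A fzero (fromℕ m) * det m (minor A (fromℕ m)))
  det-firstRowLast m A zeros = begin
    det (suc m) A
      ≈⟨ sumᶠ-punchIn m (laplaceTerm m A) (fromℕ m) ⟩
    laplaceTerm m A (fromℕ m) + sumᶠ m (λ k → laplaceTerm m A (punchIn (fromℕ m) k))
      ≈⟨ +-cong refl (sumᶠ-0 m _ vanishes) ⟩
    laplaceTerm m A (fromℕ m) + 0#
      ≈⟨ trans (+-identityʳ _) (*-cong (reflexive (≡.cong sign (toℕ-fromℕ m))) refl) ⟩
    sign m * (A fzero (fromℕ m) * det m (minor A (fromℕ m))) ∎
    where
    vanishes : ∀ k → laplaceTerm m A (punchIn (fromℕ m) k) ≈ 0#
    vanishes k = trans (reflexive (≡.cong (laplaceTerm m A) (punchIn-fromℕ m k)))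
      (trans (*-cong refl (*-cong (zeros k) refl)) (trans (*-cong refl (zeroˡ _)) (zeroʳ _)))

  vandermondeMatrix : ∀ n → (Fin n → Carrier) → Mat n
  vandermondeMatrix n x i k = pow (x i) (n ∸ suc (toℕ k))

  -- Subtracting x₀ times the next column from each column leaves
  -- (x_i - x₀) x_i^(m-1-q) in column q and clears the first row but for its last entry 1.
  det-vandermonde : ∀ n (x : Fin n → Carrier) → det n (vandermondeMatrix n x) ≈ vandermonde n x
  det-vandermonde zero    x = refl
  det-vandermonde (suc m) x = begin
    det (suc m) (vandermondeMatrix (suc m) x)
      ≈⟨ sym (Φ-addNextColumn m (detForm (suc m)) (- x fzero) Vᵀ) ⟩
    det (suc m) B
      ≈⟨ det-firstRowLast m B (λ q → trans (entry fzero q) (trans (*-cong (-‿inverseʳ _) refl) (zeroˡ _))) ⟩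
    sign m * (B fzero (fromℕ m) * det m (minor B (fromℕ m)))
      ≈⟨ *-cong refl (*-cong B₀last (det-cong m minorB)) ⟩
    sign m * (1# * det m (λ i k → (x (fsuc i) + - x fzero) * vandermondeMatrix m (tail x) i k))
      ≈⟨ *-cong refl (trans (*-identityˡ _) (det-scaleRows m _ _)) ⟩
    sign m * (prodᶠ m (λ i → x (fsuc i) + - x fzero) * det m (vandermondeMatrix m (tail x)))
      ≈⟨ sym (*-assoc _ _ _) ⟩
    (sign m * prodᶠ m (λ i → x (fsuc i) + - x fzero)) * det m (vandermondeMatrix m (tail x))
      ≈⟨ *-cong (trans (sign*prodᶠ m _) (prodᶠ-cong m (λ i → -[x-y]≈y-x _ _))) (det-vandermonde m (tail x)) ⟩
    prodᶠ m (λ j → x fzero + - x (fsuc j)) * vandermonde m (tail x)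
      ≈⟨ sym (vandermonde-∷ m x) ⟩
    vandermonde (suc m) x ∎
    where
    -[x-y]≈y-x : ∀ a b → - (a + - b) ≈ b + - a
    -[x-y]≈y-x a b = trans (sym (-‿+-comm a (- b))) (trans (+-cong refl (-‿involutive b)) (+-comm _ _))
    Vᵀ : Fin (suc m) → Col (suc m)
    Vᵀ k i = vandermondeMatrix (suc m) x i k
    B : Mat (suc m)
    B i k = addNextColumn m (- x fzero) Vᵀ k i
    entry : ∀ i (q : Fin m) → B i (inject₁ q) ≈ (x i + - x fzero) * pow (x i) (m ∸ suc (toℕ q))
    entry i q = begin
      B i (inject₁ q)
        ≈⟨ reflexive (addNextColumn-inject₁ m (- x fzero) Vᵀ q i) ⟩
      pow (x i) (m ∸ toℕ (inject₁ q)) + (- x fzero) * pow (x i) (m ∸ suc (toℕ q))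
        ≈⟨ +-cong (reflexive (≡.cong (pow (x i)) (≡.trans (≡.cong (m ∸_) (toℕ-inject₁ q)) (∸-toℕ m q)))) refl ⟩
      x i * pow (x i) (m ∸ suc (toℕ q)) + (- x fzero) * pow (x i) (m ∸ suc (toℕ q))
        ≈⟨ sym (distribʳ _ _ _) ⟩
      (x i + - x fzero) * pow (x i) (m ∸ suc (toℕ q)) ∎
    B₀last : B fzero (fromℕ m) ≈ 1#
    B₀last = reflexive (≡.trans (addNextColumn-last m (- x fzero) Vᵀ fzero)
      (≡.cong (pow (x fzero)) (≡.trans (≡.cong (m ∸_) (toℕ-fromℕ m)) (ℕ.n∸n≡0 m))))
    minorB : ∀ i k → minor B (fromℕ m) i k ≈ (x (fsuc i) + - x fzero) * vandermondeMatrix m (tail x) i k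
    minorB i k = trans (reflexive (≡.cong (B (fsuc i)) (punchIn-fromℕ m k))) (entry (fsuc i) k)

  vandermonde-moveToFront : ∀ m (x : Fin (suc m) → Carrier) (p : Fin (suc m)) →
    vandermonde (suc m) x ≈ sign (toℕ p) * vandermonde (suc m) (x p ∷ (λ k → x (punchIn p k)))
  vandermonde-moveToFront m x p = begin
    vandermonde (suc m) x
      ≈⟨ sym (det-vandermonde (suc m) x) ⟩
    det (suc m) (V x)
      ≈⟨ sym (det-transpose (suc m) (V x)) ⟩
    Φ (detForm (suc m)) (V x)
      ≈⟨ Φ-moveToFront m (detForm (suc m)) p (V x) ⟩
    sign (toℕ p) * Φ (detForm (suc m)) (V x p ∷ (λ k → V x (punchIn p k)))
      ≈⟨ *-cong refl (Φ-cong (detForm (suc m)) {V x p ∷ (λ k → V x (punchIn p k))} {V x'}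
                       (λ { fzero i → refl ; (fsuc k) i → refl })) ⟩
    sign (toℕ p) * det (suc m) (λ i k → V x' k i)
      ≈⟨ *-cong refl (trans (det-transpose (suc m) (V x')) (det-vandermonde (suc m) x')) ⟩
    sign (toℕ p) * vandermonde (suc m) x' ∎
    where
    V = vandermondeMatrix (suc m)
    x' = x p ∷ (λ k → x (punchIn p k))

-- The unit series is a parameter so that the ring below can coincide
-- definitionally with Series.psRing, whose unit is a pattern lambda.
module PowerSeries {c ℓ} (R : CommutativeRing c ℓ) (one : ℕ → CommutativeRing.Carrier R)
                   (one-zero : CommutativeRing._≈_ R (one 0) (CommutativeRing.1# R))
                   (one-suc : ∀ n → CommutativeRing._≈_ R (one (suc n)) (CommutativeRing.0# R)) where
  open BigOperators R

  PS : Set c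
  PS = ℕ → Carrier

  _≈ₛ_ : PS → PS → Set ℓ
  a ≈ₛ b = ∀ n → a n ≈ b n

  convTerm : PS → PS → (n : ℕ) → Fin (suc n) → Carrier
  convTerm a b n k = a (toℕ k) * b (n ∸ toℕ k)

  conv : PS → PS → PS
  conv a b n = sumᶠ (suc n) (convTerm a b n)

  shift : PS → PS
  shift a m = a (suc m)

  conv-cong : ∀ {a a' b b'} → a ≈ₛ a' → b ≈ₛ b' → conv a b ≈ₛ conv a' b'
  conv-cong {a} {a'} {b} {b'} ea eb n = sumᶠ-cong (suc n) {convTerm a b n} {convTerm a' b' n} (λ k → *-cong (ea _) (eb _))

  conv-suc : ∀ a b n → conv a b (suc n) ≈ conv a (shift b) n + a (suc n) * b 0
  conv-suc a b n = trans (sumᶠ-last (suc n) (convTerm a b (suc n))) (+-cong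
    (sumᶠ-cong (suc n) {λ k → convTerm a b (suc n) (inject₁ k)} {convTerm a (shift b) n} (λ k → *-cong (reflexive (≡.cong a (toℕ-inject₁ k)))
      (reflexive (≡.cong b (≡.trans (≡.cong (suc n ∸_) (toℕ-inject₁ k)) (∸-toℕ (suc n) k))))))
    (*-cong (reflexive (≡.cong a (toℕ-fromℕ (suc n))))
            (reflexive (≡.cong b (≡.trans (≡.cong (suc n ∸_) (toℕ-fromℕ (suc n))) (ℕ.n∸n≡0 (suc n)))))))

  conv-comm : ∀ a b → conv a b ≈ₛ conv b a
  conv-comm a b zero    = +-cong (*-comm _ _) refl
  conv-comm a b (suc n) = trans (+-cong refl (conv-comm (shift a) b n))
    (trans (+-comm _ _) (trans (+-cong refl (*-comm _ _)) (sym (conv-suc b a n))))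

  conv-distribˡ : ∀ a b d → conv a (λ m → b m + d m) ≈ₛ (λ m → conv a b m + conv a d m)
  conv-distribˡ a b d n = trans (sumᶠ-cong (suc n) {convTerm a (λ m → b m + d m) n} (λ k → distribˡ _ _ _))
                                (sumᶠ-+ (suc n) (convTerm a b n) (convTerm a d n))

  conv-distribʳ : ∀ a b d → conv (λ m → a m + b m) d ≈ₛ (λ m → conv a d m + conv b d m)
  conv-distribʳ a b d n = trans (sumᶠ-cong (suc n) {convTerm (λ m → a m + b m) d n} (λ k → distribʳ _ _ _))
                                (sumᶠ-+ (suc n) (convTerm a d n) (convTerm b d n))

  conv-scaleˡ : ∀ s a d → conv (λ m → s * a m) d ≈ₛ (λ m → s * conv a d m)
  conv-scaleˡ s a d n = trans (sumᶠ-cong (suc n) {convTerm (λ m → s * a m) d n} (λ k → *-assoc _ _ _))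
                              (sym (*-distribˡ-sumᶠ (suc n) s (convTerm a d n)))

  conv-zeroˡ : ∀ a d → a ≈ₛ (λ _ → 0#) → conv a d ≈ₛ (λ _ → 0#)
  conv-zeroˡ a d e n = sumᶠ-0 (suc n) (convTerm a d n) (λ k → trans (*-cong (e _) refl) (zeroˡ _))

  conv-assoc : ∀ a b d → conv (conv a b) d ≈ₛ conv a (conv b d)
  conv-assoc a b d zero = +-cong (trans (*-cong (+-identityʳ _) refl)
                                        (trans (*-assoc _ _ _) (*-cong refl (sym (+-identityʳ _))))) refl
  conv-assoc a b d (suc n) = begin
    conv a b 0 * d (suc n) + conv (λ m → a 0 * shift b m + conv (shift a) b m) d n
      ≈⟨ +-cong refl (conv-distribʳ (λ m → a 0 * shift b m) (conv (shift a) b) d n) ⟩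
    conv a b 0 * d (suc n) + (conv (λ m → a 0 * shift b m) d n + conv (conv (shift a) b) d n)
      ≈⟨ +-cong (*-cong (+-identityʳ _) refl) (+-cong (conv-scaleˡ (a 0) (shift b) d n) (conv-assoc (shift a) b d n)) ⟩
    (a 0 * b 0) * d (suc n) + (a 0 * conv (shift b) d n + conv (shift a) (conv b d) n)
      ≈⟨ sym (+-assoc _ _ _) ⟩
    ((a 0 * b 0) * d (suc n) + a 0 * conv (shift b) d n) + conv (shift a) (conv b d) n
      ≈⟨ +-cong (trans (+-cong (*-assoc _ _ _) refl) (sym (distribˡ _ _ _))) refl ⟩
    a 0 * conv b d (suc n) + conv (shift a) (conv b d) n ∎

  conv-identityˡ : ∀ a → conv one a ≈ₛ a
  conv-identityˡ a zero    = trans (+-identityʳ _) (trans (*-cong one-zero refl) (*-identityˡ _))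
  conv-identityˡ a (suc n) = trans (+-cong (*-cong one-zero refl) (conv-zeroˡ (shift one) a one-suc n))
    (trans (+-identityʳ _) (*-identityˡ _))

  -- Multiplication is opaque, so that unification never unfolds convolutions.
  opaque
    _*ₛ_ : PS → PS → PS
    _*ₛ_ = conv

  opaque
    unfolding _*ₛ_

    *ₛ-conv : ∀ a b n → (a *ₛ b) n ≡ conv a b n
    *ₛ-conv a b n = ≡.refl

    *ₛ-cong : ∀ {a a' b b'} → a ≈ₛ a' → b ≈ₛ b' → (a *ₛ b) ≈ₛ (a' *ₛ b')
    *ₛ-cong = conv-cong

    *ₛ-assoc : ∀ a b d → ((a *ₛ b) *ₛ d) ≈ₛ (a *ₛ (b *ₛ d))
    *ₛ-assoc a b d n = trans (conv-cong {conv a b} {conv a b} {d} {d} (λ _ → refl) (λ _ → refl) n) (conv-assoc a b d n)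

    *ₛ-comm : ∀ a b → (a *ₛ b) ≈ₛ (b *ₛ a)
    *ₛ-comm = conv-comm

    *ₛ-identityˡ : ∀ a → (one *ₛ a) ≈ₛ a
    *ₛ-identityˡ = conv-identityˡ

    *ₛ-distribˡ : ∀ a b d → (a *ₛ (λ m → b m + d m)) ≈ₛ (λ m → (a *ₛ b) m + (a *ₛ d) m)
    *ₛ-distribˡ = conv-distribˡ

  seriesRing : CommutativeRing c ℓ
  seriesRing = record
    { Carrier = PS
    ; _≈_     = _≈ₛ_
    ; _+_     = λ a b n → a n + b n
    ; _*_     = _*ₛ_
    ; -_      = λ a n → - a n
    ; 0#      = λ _ → 0#
    ; 1#      = one
    ; isCommutativeRing = record
      { isRing = record
        { +-isAbelianGroup = record
          { isGroup = record
            { isMonoid = record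
              { isSemigroup = record
                { isMagma = record
                  { isEquivalence = record { refl = λ n → refl ; sym = λ e n → sym (e n) ; trans = λ e f n → trans (e n) (f n) }
                  ; ∙-cong = λ e f n → +-cong (e n) (f n) }
                ; assoc = λ a b d n → +-assoc _ _ _ }
              ; identity = (λ a n → +-identityˡ _) , (λ a n → +-identityʳ _) }
            ; inverse = (λ a n → -‿inverseˡ _) , (λ a n → -‿inverseʳ _)
            ; ⁻¹-cong = λ e n → -‿cong (e n) }
          ; comm = λ a b n → +-comm _ _ }
        ; *-cong = *ₛ-cong
        ; *-assoc = *ₛ-assoc
        ; *-identity = *ₛ-identityˡ , (λ a n → trans (*ₛ-comm a one n) (*ₛ-identityˡ a n))
        ; distrib = *ₛ-distribˡ , (λ a b d n → trans (*ₛ-comm (λ m → b m + d m) a n)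
              (trans (*ₛ-distribˡ a b d n) (+-cong (*ₛ-comm a b n) (*ₛ-comm a d n)))) }
      ; *-comm = *ₛ-comm } }

mkIsRingHomomorphism : ∀ {c₁ ℓ₁ c₂ ℓ₂} (R₁ : RawRing c₁ ℓ₁) (R₂ : RawRing c₂ ℓ₂)
  {h : RawRing.Carrier R₁ → RawRing.Carrier R₂} →
  (let module R₁ = RawRing R₁; module R₂ = RawRing R₂) →
  (∀ {a b} → a R₁.≈ b → h a R₂.≈ h b) →
  (∀ a b → h (a R₁.+ b) R₂.≈ h a R₂.+ h b) → (∀ a b → h (a R₁.* b) R₂.≈ h a R₂.* h b) →
  (∀ a → h (R₁.- a) R₂.≈ R₂.- h a) → h R₁.0# R₂.≈ R₂.0# → h R₁.1# R₂.≈ R₂.1# →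
  IsRingHomomorphism R₁ R₂ h
mkIsRingHomomorphism R₁ R₂ cong +-homo *-homo -‿homo 0#-homo 1#-homo = record
  { isSemiringHomomorphism = record
    { isNearSemiringHomomorphism = record
      { +-isMonoidHomomorphism = record
        { isMagmaHomomorphism = record { isRelHomomorphism = record { cong = cong } ; homo = +-homo }
        ; ε-homo = 0#-homo }
      ; *-homo = *-homo }
    ; 1#-homo = 1#-homo }
  ; -‿homo = -‿homo }

module RingHomomorphism {c₁ ℓ₁ c₂ ℓ₂} (R₁ : RawRing c₁ ℓ₁) (R₂ : CommutativeRing c₂ ℓ₂)
  {h : RawRing.Carrier R₁ → CommutativeRing.Carrier R₂}
  (isHom : IsRingHomomorphism R₁ (CommutativeRing.rawRing R₂) h) where
  open DeterminantIdentities R₂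
  open IsRingHomomorphism isHom using (+-homo; *-homo; -‿homo; 0#-homo; 1#-homo)
  private
    module R₁ = RawRing R₁
    module O₁ = RingOps R₁

  h-sumᶠ : ∀ n f → h (O₁.sumᶠ n f) ≈ sumᶠ n (λ i → h (f i))
  h-sumᶠ zero    f = 0#-homo
  h-sumᶠ (suc n) f = trans (+-homo _ _) (+-cong refl (h-sumᶠ n _))

  h-prodᶠ : ∀ n f → h (O₁.prodᶠ n f) ≈ prodᶠ n (λ i → h (f i))
  h-prodᶠ zero    f = 1#-homo
  h-prodᶠ (suc n) f = trans (*-homo _ _) (*-cong refl (h-prodᶠ n _))

  h-sign : ∀ k → h (O₁.sign k) ≈ sign k
  h-sign zero    = 1#-homo
  h-sign (suc k) = trans (-‿homo _) (-‿cong (h-sign k))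

  h-pow : ∀ x k → h (O₁.pow x k) ≈ pow (h x) k
  h-pow x zero    = 1#-homo
  h-pow x (suc k) = trans (*-homo _ _) (*-cong refl (h-pow x k))

  h-det : ∀ n A → h (O₁.det n A) ≈ det n (λ i k → h (A i k))
  h-det zero    A = 1#-homo
  h-det (suc n) A = trans (h-sumᶠ (suc n) (λ j → O₁.sign (toℕ j) R₁.* (A fzero j R₁.* O₁.det n (λ i k → A (fsuc i) (punchIn j k)))))
    (sumᶠ-cong (suc n)
    {λ j → h (O₁.sign (toℕ j) R₁.* (A fzero j R₁.* O₁.det n (λ i k → A (fsuc i) (punchIn j k))))}
    (λ j → trans (*-homo _ _) (*-cong (h-sign (toℕ j)) (trans (*-homo _ _) (*-cong refl (h-det n _))))))

  h-vandermonde : ∀ n x → h (O₁.vandermonde n x) ≈ vandermonde n (λ i → h (x i))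
  h-vandermonde n x = trans (h-prodᶠ n _) (prodᶠ-cong n (λ i → trans (h-prodᶠ n _)
    (prodᶠ-cong n (λ j → factor i j (toℕ i <ᵇ toℕ j)))))
    where
    factor : ∀ i j b → h (if b then x i R₁.+ (R₁.- x j) else R₁.1#) ≈ (if b then h (x i) + - h (x j) else 1#)
    factor i j true  = trans (+-homo _ _) (+-cong refl (-‿homo _))
    factor i j false = 1#-homo

  h-eval : ∀ {N} (x : Fin N → R₁.Carrier) e → h (eval R₁ x e) ≈ eval rawRing (λ i → h (x i)) e
  h-eval x zer       = 0#-homo
  h-eval x one       = 1#-homo
  h-eval x (var i)   = refl
  h-eval x (add e f) = trans (+-homo _ _) (+-cong (h-eval x e) (h-eval x f))
  h-eval x (mul e f) = trans (*-homo _ _) (*-cong (h-eval x e) (h-eval x f))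
  h-eval x (neg e)   = trans (-‿homo _) (-‿cong (h-eval x e))

module FreeCommutativeRing (N : ℕ) where
  infix 4 _≋_
  data _≋_ : Expr N → Expr N → Set where
    ≋-refl    : ∀ {e} → e ≋ e
    ≋-sym     : ∀ {e f} → e ≋ f → f ≋ e
    ≋-trans   : ∀ {e f g} → e ≋ f → f ≋ g → e ≋ g
    add-cong  : ∀ {e e' f f'} → e ≋ e' → f ≋ f' → add e f ≋ add e' f'
    mul-cong  : ∀ {e e' f f'} → e ≋ e' → f ≋ f' → mul e f ≋ mul e' f'
    neg-cong  : ∀ {e e'} → e ≋ e' → neg e ≋ neg e'
    add-assoc : ∀ e f g → add (add e f) g ≋ add e (add f g)
    add-idˡ   : ∀ e → add zer e ≋ e
    add-idʳ   : ∀ e → add e zer ≋ e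
    add-comm  : ∀ e f → add e f ≋ add f e
    neg-invˡ  : ∀ e → add (neg e) e ≋ zer
    neg-invʳ  : ∀ e → add e (neg e) ≋ zer
    mul-assoc : ∀ e f g → mul (mul e f) g ≋ mul e (mul f g)
    mul-idˡ   : ∀ e → mul one e ≋ e
    mul-idʳ   : ∀ e → mul e one ≋ e
    mul-distribˡ : ∀ e f g → mul e (add f g) ≋ add (mul e f) (mul e g)
    mul-distribʳ : ∀ e f g → mul (add f g) e ≋ add (mul f e) (mul g e)
    mul-comm  : ∀ e f → mul e f ≋ mul f e

  freeRing : CommutativeRing 0ℓ 0ℓ
  freeRing = record
    { Carrier = Expr N ; _≈_ = _≋_ ; _+_ = add ; _*_ = mul ; -_ = neg ; 0# = zer ; 1# = one
    ; isCommutativeRing = record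
      { isRing = record
        { +-isAbelianGroup = record
          { isGroup = record
            { isMonoid = record
              { isSemigroup = record
                { isMagma = record
                  { isEquivalence = record { refl = ≋-refl ; sym = ≋-sym ; trans = ≋-trans }
                  ; ∙-cong = add-cong }
                ; assoc = add-assoc }
              ; identity = add-idˡ , add-idʳ }
            ; inverse = neg-invˡ , neg-invʳ
            ; ⁻¹-cong = neg-cong }
          ; comm = add-comm }
        ; *-cong = mul-cong
        ; *-assoc = mul-assoc
        ; *-identity = mul-idˡ , mul-idʳ
        ; distrib = mul-distribˡ , mul-distribʳ }
      ; *-comm = mul-comm } }

  module _ {c ℓ} (R : CommutativeRing c ℓ) (x : Fin N → CommutativeRing.Carrier R) where
    open CommutativeRing R

    eval-cong : ∀ {e f} → e ≋ f → eval rawRing x e ≈ eval rawRing x f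
    eval-cong ≋-refl              = refl
    eval-cong (≋-sym p)           = sym (eval-cong p)
    eval-cong (≋-trans p q)       = trans (eval-cong p) (eval-cong q)
    eval-cong (add-cong p q)      = +-cong (eval-cong p) (eval-cong q)
    eval-cong (mul-cong p q)      = *-cong (eval-cong p) (eval-cong q)
    eval-cong (neg-cong p)        = -‿cong (eval-cong p)
    eval-cong (add-assoc e f g)   = +-assoc _ _ _
    eval-cong (add-idˡ e)         = +-identityˡ _
    eval-cong (add-idʳ e)         = +-identityʳ _
    eval-cong (add-comm e f)      = +-comm _ _
    eval-cong (neg-invˡ e)        = -‿inverseˡ _
    eval-cong (neg-invʳ e)        = -‿inverseʳ _
    eval-cong (mul-assoc e f g)   = *-assoc _ _ _
    eval-cong (mul-idˡ e)         = *-identityˡ _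
    eval-cong (mul-idʳ e)         = *-identityʳ _
    eval-cong (mul-distribˡ e f g) = distribˡ _ _ _
    eval-cong (mul-distribʳ e f g) = distribʳ _ _ _
    eval-cong (mul-comm e f)      = *-comm _ _

    eval-isRingHomomorphism : IsRingHomomorphism (CommutativeRing.rawRing freeRing) rawRing (eval rawRing x)
    eval-isRingHomomorphism = mkIsRingHomomorphism _ _ eval-cong (λ _ _ → refl) (λ _ _ → refl) (λ _ → refl) refl refl

  eval-var : ∀ {c ℓ} (R : RawRing c ℓ) (x : Fin N → RawRing.Carrier R) e →
    eval R x (eval (CommutativeRing.rawRing freeRing) var e) ≡ eval R x e
  eval-var R x zer       = ≡.refl
  eval-var R x one       = ≡.refl
  eval-var R x (var i)   = ≡.refl
  eval-var R x (add e f) = ≡.cong₂ (RawRing._+_ R) (eval-var R x e) (eval-var R x f)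
  eval-var R x (mul e f) = ≡.cong₂ (RawRing._*_ R) (eval-var R x e) (eval-var R x f)
  eval-var R x (neg e)   = ≡.cong (RawRing.-_ R) (eval-var R x e)

-- IsSchur only quantifies over rings in Set; instantiating it at the free
-- ring and evaluating transfers it to rings of every universe level.
IsSchur-anyRing : ∀ {c ℓ} (R : CommutativeRing c ℓ) N λp e → IsSchur N λp e →
  ∀ (x : Fin N → CommutativeRing.Carrier R) →
  let open CommutativeRing R; open RingOps rawRing in
  eval rawRing x e * vandermonde N x ≈ det N (λ i j → pow (x i) (λp j +ℕ (N ∸ suc (toℕ j))))
IsSchur-anyRing R N λp e schur x = begin
  eval rawRing x e * vandermonde N x
    ≈⟨ *-cong (reflexive (≡.sym (eval-var rawRing x e))) (sym (h-vandermonde N var)) ⟩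
  eval rawRing x (eval (CommutativeRing.rawRing freeRing) var e) * eval rawRing x (vandermonde' N var)
    ≈⟨ eval-cong R x (schur freeRing var) ⟩
  eval rawRing x (det' N (λ i j → pow' (var i) (λp j +ℕ (N ∸ suc (toℕ j)))))
    ≈⟨ trans (h-det N _) (det-cong N (λ i k → h-pow (var i) (λp k +ℕ (N ∸ suc (toℕ k))))) ⟩
  det N (λ i j → pow (x i) (λp j +ℕ (N ∸ suc (toℕ j)))) ∎
  where
  open DeterminantIdentities R
  open FreeCommutativeRing N
  open RingOps (CommutativeRing.rawRing freeRing) using () renaming (vandermonde to vandermonde'; det to det'; pow to pow')
  open RingHomomorphism (CommutativeRing.rawRing freeRing) R (eval-isRingHomomorphism R x)

module HookExponents (M n : ℕ) (N≤M : suc n ≤ M) where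

  -- The exponents of z in p_t, listed as (M, N-1, N-2, …, 0).
  exponent : Fin (suc (suc n)) → ℕ
  exponent fzero    = M
  exponent (fsuc m) = suc n ∸ suc (toℕ m)

  ∸-punchIn : ∀ m (j : Fin (suc m)) (k : Fin m) →
    m ∸ toℕ (punchIn j k) ≡ (if toℕ k <ᵇ toℕ j then 1 else 0) +ℕ (m ∸ suc (toℕ k))
  ∸-punchIn m       fzero    k        = ≡.refl
  ∸-punchIn (suc m) (fsuc j) fzero    = ≡.refl
  ∸-punchIn (suc m) (fsuc j) (fsuc k) = ∸-punchIn m j k

  ∸-opposite : ∀ m (j : Fin (suc m)) → suc m ∸ toℕ (opposite j) ≡ suc (toℕ j)
  ∸-opposite m j = ≡.trans (≡.cong (suc m ∸_) (opposite-prop j))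
    (≡.trans (ℕ.+-∸-assoc 1 (ℕ.m∸n≤m m (toℕ j))) (≡.cong suc (ℕ.m∸[m∸n]≡n (toℕ≤pred[n] j))))

  exponent-hook : ∀ (j' k : Fin (suc n)) →
    exponent (punchIn (fsuc j') k) ≡ hook M (suc n) (opposite j') k +ℕ (suc n ∸ suc (toℕ k))
  exponent-hook j' fzero     = ≡.sym (≡.trans (≡.sym (ℕ.+-suc (M ∸ suc n) n)) (ℕ.m∸n+n≡m N≤M))
  exponent-hook j' (fsuc k') = ≡.trans (∸-punchIn n j' k')
    (≡.cong (λ z → (if suc (toℕ k') <ᵇ z then 1 else 0) +ℕ (n ∸ suc (toℕ k'))) (≡.sym (∸-opposite n j')))

module DeterminantFormula {a ℓ} (F : Field a ℓ) (M n : ℕ) (N≤M : suc n ≤ M)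
  (c : Fin (suc n) → Field.Carrier F) (c≢0 : ∀ j → ¬ (Field._≈_ F (c j) (Field.0# F)))
  (s : Fin (suc n) → Expr (suc n)) (schur : ∀ j → IsSchur (suc n) (hook M (suc n) j) (s j))
  (u v : Fin (suc n) → Field.Carrier F) where

  N : ℕ
  N = suc n

  module 𝔽 = DeterminantIdentities (Field.commutativeRing F)
  open Field F using (_⁻¹; ⁻¹-inverse)
  open Series F using (tVar; const; psRing)
  open PowerSeries (Field.commutativeRing F) (RawRing.1# psRing) 𝔽.refl (λ _ → 𝔽.refl)
    using (PS; seriesRing; conv-zeroˡ; *ₛ-conv; _*ₛ_)
  open DeterminantIdentities seriesRing
  open HookExponents M n N≤M

  pₜ : 𝔽.Carrier → PS
  pₜ z = (tVar * const (𝔽.sumᶠ N (λ m → c m 𝔽.* 𝔽.pow z (toℕ m)))) + (- const (𝔽.pow z M))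

  const-isRingHomomorphism : IsRingHomomorphism 𝔽.rawRing rawRing const
  const-isRingHomomorphism = mkIsRingHomomorphism _ _ const-cong const-+ const-* const-- const-0 const-1
    where
    const-cong : ∀ {x y} → x 𝔽.≈ y → const x ≈ const y
    const-cong e zero    = e
    const-cong e (suc m) = 𝔽.refl
    const-+ : ∀ x y → const (x 𝔽.+ y) ≈ const x + const y
    const-+ x y zero    = 𝔽.refl
    const-+ x y (suc m) = 𝔽.sym (𝔽.+-identityʳ 𝔽.0#)
    const-* : ∀ x y → const (x 𝔽.* y) ≈ const x * const y
    const-* x y zero    = 𝔽.trans (𝔽.sym (𝔽.+-identityʳ _)) (𝔽.reflexive (≡.sym (*ₛ-conv (const x) (const y) 0)))
    const-* x y (suc m) = 𝔽.trans (𝔽.sym (𝔽.trans (𝔽.+-cong (𝔽.zeroʳ x)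
                                   (conv-zeroˡ (λ m → const x (suc m)) (const y) (λ _ → 𝔽.refl) m)) (𝔽.+-identityʳ _)))
                                 (𝔽.reflexive (≡.sym (*ₛ-conv (const x) (const y) (suc m))))
    const-- : ∀ x → const (𝔽.- x) ≈ - const x
    const-- x zero    = 𝔽.refl
    const-- x (suc m) = 𝔽.sym 𝔽.-0#≈0#
    const-0 : const 𝔽.0# ≈ 0#
    const-0 zero    = 𝔽.refl
    const-0 (suc m) = 𝔽.refl
    const-1 : const 𝔽.1# ≈ 1#
    const-1 zero    = 𝔽.refl
    const-1 (suc m) = 𝔽.refl

  open RingHomomorphism 𝔽.rawRing seriesRing const-isRingHomomorphism
  open IsRingHomomorphism const-isRingHomomorphism using (⟦⟧-cong) renaming (*-homo to const-*)

  weight : Fin (suc N) → PS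
  weight fzero    = - 1#
  weight (fsuc m) = tVar * const (c (opposite m))

  powerCol : Fin (suc N) → Col N
  powerCol l i = const (𝔽.pow (u i) (exponent l))

  weightedRow : Fin (suc N) → Fin N → PS
  weightedRow l k = weight l * const (𝔽.pow (v k) (exponent l))

  pₜ-expansion : ∀ i k → pₜ (u i 𝔽.* v k) ≈ sumᶠ (suc N) (λ l → weightedRow l k * powerCol l i)
  pₜ-expansion i k = sym (begin
    sumᶠ (suc N) (λ l → weightedRow l k * powerCol l i)
      ≈⟨ +-cong first (sumᶠ-cong N {λ m → weightedRow (fsuc m) k * powerCol (fsuc m) i} term) ⟩
    - const (𝔽.pow z M) + sumᶠ N (λ m → tVar * const (c (opposite m) 𝔽.* 𝔽.pow z (N ∸ suc (toℕ m))))
      ≈⟨ +-cong refl (sym (*-distribˡ-sumᶠ N tVar (λ m → const (c (opposite m) 𝔽.* 𝔽.pow z (N ∸ suc (toℕ m)))))) ⟩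
    - const (𝔽.pow z M) + tVar * sumᶠ N (λ m → const (c (opposite m) 𝔽.* 𝔽.pow z (N ∸ suc (toℕ m))))
      ≈⟨ +-cong refl (*-cong refl (sym (h-sumᶠ N (λ m → c (opposite m) 𝔽.* 𝔽.pow z (N ∸ suc (toℕ m)))))) ⟩
    - const (𝔽.pow z M) + tVar * const (𝔽.sumᶠ N (λ m → c (opposite m) 𝔽.* 𝔽.pow z (N ∸ suc (toℕ m))))
      ≈⟨ +-cong refl (*-cong refl (⟦⟧-cong (𝔽.trans
           (𝔽.sumᶠ-cong N {λ m → c (opposite m) 𝔽.* 𝔽.pow z (N ∸ suc (toℕ m))} (λ m → 𝔽.*-cong 𝔽.refl (𝔽.reflexive (≡.cong (𝔽.pow z) (≡.sym (opposite-prop m))))))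
           (𝔽.sumᶠ-opposite N (λ m → c m 𝔽.* 𝔽.pow z (toℕ m)))))) ⟩
    - const (𝔽.pow z M) + tVar * const (𝔽.sumᶠ N (λ m → c m 𝔽.* 𝔽.pow z (toℕ m)))
      ≈⟨ +-comm _ _ ⟩
    pₜ z ∎)
    where
    z = u i 𝔽.* v k
    powers : ∀ e → const (𝔽.pow (v k) e) * const (𝔽.pow (u i) e) ≈ const (𝔽.pow z e)
    powers e = trans (sym (const-* _ _)) (⟦⟧-cong (𝔽.trans (𝔽.*-comm _ _) (𝔽.sym (𝔽.pow-* (u i) (v k) e))))
    first : weightedRow fzero k * powerCol fzero i ≈ - const (𝔽.pow z M)
    first = trans (*-assoc _ _ _) (trans (-1*x≈-x _) (-‿cong (powers M)))
    term : ∀ m → weightedRow (fsuc m) k * powerCol (fsuc m) i ≈ tVar * const (c (opposite m) 𝔽.* 𝔽.pow z (N ∸ suc (toℕ m)))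
    term m = trans (*-assoc _ _ _) (trans (*-assoc _ _ _)
               (*-cong refl (trans (*-cong refl (powers (N ∸ suc (toℕ m)))) (sym (const-* _ _)))))

  cauchyBinetTerm : Fin (suc N) → PS
  cauchyBinetTerm r = det N (λ i k → powerCol (punchIn r k) i) * det N (λ r' k → weightedRow (punchIn r r') k)

  det-pₜ-cauchyBinet : det N (λ i k → pₜ (u i 𝔽.* v k)) ≈ sumᶠ (suc N) cauchyBinetTerm
  det-pₜ-cauchyBinet = begin
    det N (λ i k → pₜ (u i 𝔽.* v k))
      ≈⟨ det-cong N pₜ-expansion ⟩
    Φ (detForm N) (λ k i → sumᶠ (suc N) (λ l → weightedRow l k * powerCol l i))
      ≈⟨ cauchyBinet (suc N) N (detForm N) powerCol weightedRow ⟩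
    sumSubsets N (suc N) f
      ≈⟨ sumSubsets-allButOne N f ext ⟩
    sumᶠ (suc N) cauchyBinetTerm ∎
    where
    f : (Fin N → Fin (suc N)) → PS
    f g = Φ (detForm N) (λ k → powerCol (g k)) * det N (λ r k → weightedRow (g r) k)
    ext : Extensional f
    ext g g' e = *-cong (det-cong N (λ i k → reflexive (≡.cong (λ z → powerCol z i) (e k))))
                        (det-cong N (λ r k → reflexive (≡.cong (λ z → weightedRow z k) (e r))))

  det-constPow : ∀ (x : Fin N → 𝔽.Carrier) (ex : Fin N → ℕ) →
    det N (λ i k → const (𝔽.pow (x i) (ex k))) ≈ const (𝔽.det N (λ i k → 𝔽.pow (x i) (ex k)))
  det-constPow x ex = sym (h-det N (λ i k → 𝔽.pow (x i) (ex k)))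

  det-constPowᵀ : ∀ (x : Fin N → 𝔽.Carrier) (ex : Fin N → ℕ) →
    det N (λ r k → const (𝔽.pow (x k) (ex r))) ≈ const (𝔽.det N (λ i k → 𝔽.pow (x i) (ex k)))
  det-constPowᵀ x ex = trans (det-transpose N (λ i k → const (𝔽.pow (x i) (ex k)))) (det-constPow x ex)

  D : 𝔽.Carrier
  D = 𝔽.vandermonde N u 𝔽.* 𝔽.vandermonde N v 𝔽.* 𝔽.prodᶠ N c

  cauchyBinetTerm-zero : cauchyBinetTerm fzero ≈ pow tVar N * const D
  cauchyBinetTerm-zero = begin
    det N (λ i k → powerCol (fsuc k) i) * det N (λ r' k → weightedRow (fsuc r') k)
      ≈⟨ *-cong (trans (det-constPow u (λ k → N ∸ suc (toℕ k))) (⟦⟧-cong (𝔽.det-vandermonde N u)))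
                (det-scaleRows N (λ r' → weight (fsuc r')) (λ r' k → const (𝔽.pow (v k) (exponent (fsuc r'))))) ⟩
    const (𝔽.vandermonde N u) * (prodᶠ N (λ r' → tVar * const (c (opposite r'))) * det N (λ r' k → const (𝔽.pow (v k) (exponent (fsuc r')))))
      ≈⟨ *-cong refl (*-cong weights (trans (det-constPowᵀ v (λ k → N ∸ suc (toℕ k))) (⟦⟧-cong (𝔽.det-vandermonde N v)))) ⟩
    const (𝔽.vandermonde N u) * ((pow tVar N * const (𝔽.prodᶠ N c)) * const (𝔽.vandermonde N v))
      ≈⟨ solve 4 (λ U T C V → (U ⊗ ((T ⊗ C) ⊗ V)) ⊜ (T ⊗ ((U ⊗ V) ⊗ C))) refl _ _ _ _ ⟩
    pow tVar N * ((const (𝔽.vandermonde N u) * const (𝔽.vandermonde N v)) * const (𝔽.prodᶠ N c))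
      ≈⟨ *-cong refl (sym (trans (const-* _ _) (*-cong (const-* _ _) refl))) ⟩
    pow tVar N * const D ∎
    where
    weights : prodᶠ N (λ r' → tVar * const (c (opposite r'))) ≈ pow tVar N * const (𝔽.prodᶠ N c)
    weights = trans (prodᶠ-* N (λ _ → tVar) (λ r' → const (c (opposite r'))))
      (*-cong (prodᶠ-const N tVar) (trans (sym (h-prodᶠ N (λ r' → c (opposite r')))) (⟦⟧-cong (𝔽.prodᶠ-opposite N c))))

  sᵤ sᵥ : Fin N → 𝔽.Carrier
  sᵤ j = eval 𝔽.rawRing u (s j)
  sᵥ j = eval 𝔽.rawRing v (s j)

  cOmitting : Fin N → 𝔽.Carrier
  cOmitting j' = 𝔽.prodᶠ n (λ r → c (opposite (punchIn j' r)))

  omittedTerm : Fin N → 𝔽.Carrier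
  omittedTerm j' = (sᵤ (opposite j') 𝔽.* 𝔽.vandermonde N u) 𝔽.* (sᵥ (opposite j') 𝔽.* 𝔽.vandermonde N v) 𝔽.* cOmitting j'

  det-hookPowers : ∀ (x : Fin N → 𝔽.Carrier) (j' : Fin N) →
    const (𝔽.det N (λ i k → 𝔽.pow (x i) (exponent (punchIn (fsuc j') k))))
      ≈ const (eval 𝔽.rawRing x (s (opposite j')) 𝔽.* 𝔽.vandermonde N x)
  det-hookPowers x j' = ⟦⟧-cong (𝔽.trans (𝔽.det-cong N (λ i k → 𝔽.reflexive (≡.cong (𝔽.pow (x i)) (exponent-hook j' k))))
    (𝔽.sym (IsSchur-anyRing (Field.commutativeRing F) N (hook M N (opposite j')) (s (opposite j')) (schur (opposite j')) x)))

  cauchyBinetTerm-suc : ∀ j' → cauchyBinetTerm (fsuc j') ≈ - (pow tVar n * const (omittedTerm j'))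
  cauchyBinetTerm-suc j' = begin
    det N (λ i k → powerCol (punchIn (fsuc j') k) i) * det N (λ r' k → weightedRow (punchIn (fsuc j') r') k)
      ≈⟨ *-cong (trans (det-constPow u (λ k → exponent (punchIn (fsuc j') k))) (det-hookPowers u j'))
                (det-scaleRows N (λ r' → weight (punchIn (fsuc j') r')) (λ r' k → const (𝔽.pow (v k) (exponent (punchIn (fsuc j') r'))))) ⟩
    Sᵤ * (((- 1#) * prodᶠ n (λ r → tVar * const (c (opposite (punchIn j' r))))) * det N (λ r' k → const (𝔽.pow (v k) (exponent (punchIn (fsuc j') r')))))
      ≈⟨ *-cong refl (*-cong (trans (-1*x≈-x _) (-‿cong weights))
                             (trans (det-constPowᵀ v (λ k → exponent (punchIn (fsuc j') k))) (det-hookPowers v j'))) ⟩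
    Sᵤ * ((- (pow tVar n * const (cOmitting j'))) * Sᵥ)
      ≈⟨ trans (*-cong refl (sym (-‿distribˡ-* _ _))) (sym (-‿distribʳ-* _ _)) ⟩
    - (Sᵤ * ((pow tVar n * const (cOmitting j')) * Sᵥ))
      ≈⟨ -‿cong (solve 4 (λ U T C V → (U ⊗ ((T ⊗ C) ⊗ V)) ⊜ (T ⊗ ((U ⊗ V) ⊗ C))) refl _ _ _ _) ⟩
    - (pow tVar n * ((Sᵤ * Sᵥ) * const (cOmitting j')))
      ≈⟨ -‿cong (*-cong refl (sym (trans (const-* _ _) (*-cong (const-* _ _) refl)))) ⟩
    - (pow tVar n * const (omittedTerm j')) ∎
    where
    Sᵤ = const (sᵤ (opposite j') 𝔽.* 𝔽.vandermonde N u)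
    Sᵥ = const (sᵥ (opposite j') 𝔽.* 𝔽.vandermonde N v)
    weights : prodᶠ n (λ r → tVar * const (c (opposite (punchIn j' r)))) ≈ pow tVar n * const (cOmitting j')
    weights = trans (prodᶠ-* n (λ _ → tVar) (λ r → const (c (opposite (punchIn j' r)))))
      (*-cong (prodᶠ-const n tVar) (sym (h-prodᶠ n (λ r → c (opposite (punchIn j' r))))))

  sᵤsᵥ/c : Fin N → 𝔽.Carrier
  sᵤsᵥ/c j = sᵤ j 𝔽.* sᵥ j 𝔽.* (c j ⁻¹)

  -- Π c = c_j · Π_{m≠j} c_m and c_j c_j⁻¹ = 1.
  D*sum≈sum-omittedTerm : D 𝔽.* 𝔽.sumᶠ N sᵤsᵥ/c 𝔽.≈ 𝔽.sumᶠ N omittedTerm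
  D*sum≈sum-omittedTerm = 𝔽.trans (𝔽.*-distribˡ-sumᶠ N D sᵤsᵥ/c)
    (𝔽.trans (𝔽.sym (𝔽.sumᶠ-opposite N (λ j → D 𝔽.* sᵤsᵥ/c j))) (𝔽.sumᶠ-cong N {λ j' → D 𝔽.* sᵤsᵥ/c (opposite j')} term))
    where
    term : ∀ j' → D 𝔽.* sᵤsᵥ/c (opposite j') 𝔽.≈ omittedTerm j'
    term j' = 𝔽.trans (𝔽.*-cong (𝔽.*-cong 𝔽.refl (𝔽.trans (𝔽.sym (𝔽.prodᶠ-opposite N c)) (𝔽.prodᶠ-punchIn n (λ r → c (opposite r)) j'))) 𝔽.refl)
      (𝔽.trans (𝔽.solve 7 (λ Vu Vv cj Π su sv cj⁻¹ → ((Vu 𝔽.⊗ Vv) 𝔽.⊗ (cj 𝔽.⊗ Π)) 𝔽.⊗ ((su 𝔽.⊗ sv) 𝔽.⊗ cj⁻¹)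
                                   𝔽.⊜ ((((su 𝔽.⊗ Vu) 𝔽.⊗ (sv 𝔽.⊗ Vv)) 𝔽.⊗ Π) 𝔽.⊗ (cj 𝔽.⊗ cj⁻¹))) 𝔽.refl
                  (𝔽.vandermonde N u) (𝔽.vandermonde N v) (c j) (cOmitting j') (sᵤ j) (sᵥ j) (c j ⁻¹))
      (𝔽.trans (𝔽.*-cong 𝔽.refl (⁻¹-inverse (c j) (c≢0 j))) (𝔽.*-identityʳ _)))
      where
      j = opposite j'

  det-pₜ-factorised : det N (λ i k → pₜ (u i 𝔽.* v k)) ≈ pow tVar n * (const D * (tVar + (- const (𝔽.sumᶠ N sᵤsᵥ/c))))
  det-pₜ-factorised = begin
    det N (λ i k → pₜ (u i 𝔽.* v k))
      ≈⟨ det-pₜ-cauchyBinet ⟩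
    cauchyBinetTerm fzero + sumᶠ N (λ j' → cauchyBinetTerm (fsuc j'))
      ≈⟨ +-cong cauchyBinetTerm-zero (sumᶠ-cong N {λ j' → cauchyBinetTerm (fsuc j')} cauchyBinetTerm-suc) ⟩
    pow tVar N * const D + sumᶠ N (λ j' → - (pow tVar n * const (omittedTerm j')))
      ≈⟨ +-cong refl (trans (sym (-‿sumᶠ N (λ j' → pow tVar n * const (omittedTerm j'))))
           (-‿cong (trans (sym (*-distribˡ-sumᶠ N (pow tVar n) (λ j' → const (omittedTerm j')))) (*-cong refl (sym (h-sumᶠ N omittedTerm)))))) ⟩
    pow tVar N * const D + - (pow tVar n * const (𝔽.sumᶠ N omittedTerm))
      ≈⟨ +-cong (solve 3 (λ t T d → ((t ⊗ T) ⊗ d) ⊜ (T ⊗ (d ⊗ t))) refl tVar (pow tVar n) (const D))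
                (-‿cong (*-cong refl (trans (⟦⟧-cong (𝔽.sym D*sum≈sum-omittedTerm)) (const-* D (𝔽.sumᶠ N sᵤsᵥ/c))))) ⟩
    pow tVar n * (const D * tVar) + - (pow tVar n * (const D * const (𝔽.sumᶠ N sᵤsᵥ/c)))
      ≈⟨ +-cong refl (trans (-‿distribʳ-* _ _) (*-cong refl (-‿distribʳ-* _ _))) ⟩
    pow tVar n * (const D * tVar) + pow tVar n * (const D * (- const (𝔽.sumᶠ N sᵤsᵥ/c)))
      ≈⟨ trans (sym (distribˡ _ _ _)) (*-cong refl (sym (distribˡ _ _ _))) ⟩
    pow tVar n * (const D * (tVar + (- const (𝔽.sumᶠ N sᵤsᵥ/c)))) ∎

  opaque
    unfolding _*ₛ_

    det-pₜ[uvᵀ] :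
      let module T = RawRing psRing
          module P = RingOps psRing
          pₜ′ : 𝔽.Carrier → PS
          pₜ′ z = (tVar T.* const (𝔽.sumᶠ N (λ m → c m 𝔽.* 𝔽.pow z (toℕ m)))) T.+ (T.- const (𝔽.pow z M))
      in P.det N (λ i k → pₜ′ (u i 𝔽.* v k))
           T.≈ (P.pow tVar n T.* (const D T.* (tVar T.+ (T.- const (𝔽.sumᶠ N sᵤsᵥ/c)))))
    det-pₜ[uvᵀ] = det-pₜ-factorised

-- Principal specialisation: over ℤ[[ε]] put q = 1 + ε and x_i = q^(d_i).
-- Both Vandermonde determinants in the Schur identity become
-- ε^(N choose 2) times Vandermonde determinants of q-integers [d]_q, the
-- power of ε cancels, and setting ε = 0 turns [d]_q into d.
module PrincipalSpecialisation where
  open import Data.Integer using (ℤ; +_)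
  open import Data.Integer.Properties using (+-*-commutativeRing)

  ℤ-ring : CommutativeRing 0ℓ 0ℓ
  ℤ-ring = +-*-commutativeRing
  module Z = DeterminantIdentities ℤ-ring

  oneℤ : ℕ → ℤ
  oneℤ zero    = + 1
  oneℤ (suc _) = + 0

  open PowerSeries ℤ-ring oneℤ ≡.refl (λ _ → ≡.refl) using (PS; seriesRing; conv-cong; conv-identityˡ; *ₛ-conv)
  open DeterminantIdentities seriesRing

  ε : PS
  ε zero          = + 0
  ε (suc zero)    = + 1
  ε (suc (suc _)) = + 0

  q : PS
  q = 1# + ε

  [_]q : ℕ → PS
  [ zero  ]q = 0#
  [ suc m ]q = pow q m + [ m ]q

  pow-q : ∀ m → pow q m ≈ 1# + ε * [ m ]q
  pow-q zero    = sym (trans (+-cong (refl {1#}) (zeroʳ ε)) (+-identityʳ 1#))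
  pow-q (suc m) = begin
    (1# + ε) * pow q m               ≈⟨ distribʳ (pow q m) 1# ε ⟩
    1# * pow q m + ε * pow q m       ≈⟨ +-cong (trans (*-identityˡ (pow q m)) (pow-q m)) refl ⟩
    (1# + ε * [ m ]q) + ε * pow q m  ≈⟨ +-assoc 1# (ε * [ m ]q) (ε * pow q m) ⟩
    1# + (ε * [ m ]q + ε * pow q m)  ≈⟨ +-cong (refl {1#}) (trans (sym (distribˡ ε [ m ]q (pow q m))) (*-cong (refl {ε}) (+-comm [ m ]q (pow q m)))) ⟩
    1# + ε * [ suc m ]q              ∎

  vandermonde-qPowers : ∀ n (d : Fin n → ℕ) →
    vandermonde n (λ i → pow q (d i)) ≈ triangularPow n ε * vandermonde n (λ i → [ d i ]q)
  vandermonde-qPowers n d = trans (vandermonde-cong n (λ i → pow-q (d i))) (vandermonde-affine n 1# ε (λ i → [ d i ]q))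

  Cancellable : PS → Set
  Cancellable x = ∀ a b → x * a ≈ x * b → a ≈ b

  ε*-shift : ∀ a k → (ε * a) (suc k) ≡ a k
  ε*-shift a k = ≡.trans (*ₛ-conv ε a (suc k))
    (≡.trans (Z.+-identityˡ _) (≡.trans (conv-cong {λ m → ε (suc m)} {oneℤ} {a} {a}
      (λ { zero → ≡.refl ; (suc m) → ≡.refl }) (λ _ → ≡.refl) k) (conv-identityˡ a k)))

  ε-cancellable : Cancellable ε
  ε-cancellable a b e k = ≡.trans (≡.sym (ε*-shift a k)) (≡.trans (e (suc k)) (ε*-shift b k))

  1-cancellable : Cancellable 1#
  1-cancellable a b e = trans (sym (*-identityˡ a)) (trans e (*-identityˡ b))

  *-cancellable : ∀ {x y} → Cancellable x → Cancellable y → Cancellable (x * y)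
  *-cancellable {x} {y} cx cy a b e = cy a b (cx _ _ (trans (sym (*-assoc x y a)) (trans e (*-assoc x y b))))

  prodᶠ-cancellable : ∀ n (f : Fin n → PS) → (∀ i → Cancellable (f i)) → Cancellable (prodᶠ n f)
  prodᶠ-cancellable zero    f cf = 1-cancellable
  prodᶠ-cancellable (suc n) f cf = *-cancellable (cf fzero) (prodᶠ-cancellable n (tail f) (λ i → cf (fsuc i)))

  triangularPow-cancellable : ∀ n → Cancellable (triangularPow n ε)
  triangularPow-cancellable n = prodᶠ-cancellable n _ (λ i → prodᶠ-cancellable n _ (λ j → factor (toℕ i <ᵇ toℕ j)))
    where
    factor : ∀ b → Cancellable (if b then ε else 1#)
    factor true  = ε-cancellable
    factor false = 1-cancellable

  constantTerm : PS → ℤ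
  constantTerm a = a 0

  constantTerm-isRingHomomorphism : IsRingHomomorphism rawRing Z.rawRing constantTerm
  constantTerm-isRingHomomorphism = mkIsRingHomomorphism _ _ (λ e → e 0) (λ _ _ → ≡.refl)
    (λ a b → ≡.trans (*ₛ-conv a b 0) (Z.+-identityʳ _)) (λ _ → ≡.refl) ≡.refl ≡.refl

  open RingHomomorphism rawRing ℤ-ring constantTerm-isRingHomomorphism

  constantTerm-pow-q : ∀ k → constantTerm (pow q k) ≡ + 1
  constantTerm-pow-q k = ≡.trans (h-pow q k) (pow-one k)
    where
    pow-one : ∀ k → Z.pow (+ 1) k ≡ + 1
    pow-one zero    = ≡.refl
    pow-one (suc k) = ≡.trans (Z.*-identityˡ _) (pow-one k)

  constantTerm-[]q : ∀ m → constantTerm [ m ]q ≡ + m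
  constantTerm-[]q zero    = ≡.refl
  constantTerm-[]q (suc m) = ≡.cong₂ Z._+_ (constantTerm-pow-q m) (constantTerm-[]q m)

  eval-cong : ∀ {c ℓ} (R : RawRing c ℓ) {N} {x y : Fin N → RawRing.Carrier R} → (∀ i → x i ≡ y i) →
    ∀ e → eval R x e ≡ eval R y e
  eval-cong R e zer       = ≡.refl
  eval-cong R e one       = ≡.refl
  eval-cong R e (var i)   = e i
  eval-cong R e (add a b) = ≡.cong₂ (RawRing._+_ R) (eval-cong R e a) (eval-cong R e b)
  eval-cong R e (mul a b) = ≡.cong₂ (RawRing._*_ R) (eval-cong R e a) (eval-cong R e b)
  eval-cong R e (neg a)   = ≡.cong (RawRing.-_ R) (eval-cong R e a)

  module _ (N : ℕ) (λp : Partition N) (e : Expr N) (schur : IsSchur N λp e) where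

    staircase shifted : Fin N → ℕ
    staircase i = N ∸ suc (toℕ i)
    shifted   k = λp k +ℕ (N ∸ suc (toℕ k))

    qSpecialised : (eval rawRing (λ i → pow q (staircase i)) e * vandermonde N (λ i → [ staircase i ]q))
                     ≈ vandermonde N (λ k → [ shifted k ]q)
    qSpecialised = triangularPow-cancellable N _ _ (begin
      triangularPow N ε * (eₓ * vandermonde N (λ i → [ staircase i ]q))
        ≈⟨ x*yz≈y*xz _ _ _ ⟩
      eₓ * (triangularPow N ε * vandermonde N (λ i → [ staircase i ]q))
        ≈⟨ *-cong refl (sym (vandermonde-qPowers N staircase)) ⟩
      eₓ * vandermonde N x
        ≈⟨ schur seriesRing x ⟩
      det N (λ i k → pow (pow q (staircase i)) (shifted k))
        ≈⟨ det-cong N (λ i k → pow-comm q (staircase i) (shifted k)) ⟩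
      det N (λ i k → vandermondeMatrix N (λ k → pow q (shifted k)) k i)
        ≈⟨ trans (det-transpose N _) (det-vandermonde N _) ⟩
      vandermonde N (λ k → pow q (shifted k))
        ≈⟨ vandermonde-qPowers N shifted ⟩
      triangularPow N ε * vandermonde N (λ k → [ shifted k ]q) ∎)
      where
      x : Fin N → PS
      x i = pow q (staircase i)
      eₓ = eval rawRing x e

    schur-atOnes : eval Z.rawRing (λ _ → + 1) e Z.* Z.vandermonde N (λ i → + staircase i)
                     ≡ Z.vandermonde N (λ k → + shifted k)
    schur-atOnes = ≡.trans (≡.cong₂ Z._*_ eval-atOnes (≡.sym (constantTerm-vandermonde staircase)))
      (≡.trans (≡.sym (*-homo _ _)) (≡.trans (qSpecialised 0) (constantTerm-vandermonde shifted)))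
      where
      open IsRingHomomorphism constantTerm-isRingHomomorphism using (*-homo)
      eval-atOnes : eval Z.rawRing (λ _ → + 1) e ≡ constantTerm (eval rawRing (λ i → pow q (staircase i)) e)
      eval-atOnes = ≡.trans (≡.sym (eval-cong _ (λ i → constantTerm-pow-q (staircase i)) e))
                            (≡.sym (h-eval (λ i → pow q (staircase i)) e))
      constantTerm-vandermonde : ∀ d → constantTerm (vandermonde N (λ i → [ d i ]q)) ≡ Z.vandermonde N (λ i → + d i)
      constantTerm-vandermonde d = ≡.trans (h-vandermonde N (λ i → [ d i ]q))
                                           (Z.vandermonde-cong N (λ i → constantTerm-[]q (d i)))

module StaircaseProducts where
  open import Data.Integer as ℤ using (ℤ; +_)
  import Data.Integer.Properties as ℤ
  open import Data.Integer.Tactic.RingSolver using (solve-∀)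
  open import Data.Nat.Combinatorics using (_C_; [n-k]*[n-k-1]!≡[n-k]!; k![n∸k]!∣n!; nCk≡n!/k![n-k]!)
  open import Data.Nat.DivMod using (m/n*n≡m)
  open PrincipalSpecialisation using (module Z)

  +-∸ : ∀ {m k} → k ≤ m → + (m ∸ k) ≡ + m ℤ.- + k
  +-∸ {m} {k} k≤m = ≡.sym (≡.trans (ℤ.[+m]-[+n]≡m⊖n m k) (ℤ.⊖-≥ k≤m))

  staircase-difference : ∀ n a i → a ≤ n → i ≤ n → + (n ∸ a) ℤ.- + (n ∸ i) ≡ + i ℤ.- + a
  staircase-difference n a i a≤n i≤n rewrite +-∸ a≤n | +-∸ i≤n = lemma (+ n) (+ a) (+ i)
    where
    lemma : ∀ x y z → (x ℤ.- y) ℤ.- (x ℤ.- z) ≡ z ℤ.- y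
    lemma = solve-∀

  suc-difference : ∀ a b → + suc a ℤ.- + suc b ≡ + a ℤ.- + b
  suc-difference a b = ≡.trans (ℤ.[+m]-[+n]≡m⊖n (suc a) (suc b))
    (≡.trans (ℤ.[1+m]⊖[1+n]≡m⊖n a b) (≡.sym (ℤ.[+m]-[+n]≡m⊖n a b)))

  prodᶠ-suc : ∀ n → Z.prodᶠ n (λ k → + suc (toℕ k)) ≡ + (n !)
  prodᶠ-suc zero    = ≡.refl
  prodᶠ-suc (suc n) = ≡.trans (Z.prodᶠ-last n (λ k → + suc (toℕ k)))
    (≡.trans (≡.cong₂ ℤ._*_ (≡.trans (Z.prodᶠ-cong n (λ k → ≡.cong (λ z → + suc z) (toℕ-inject₁ k))) (prodᶠ-suc n))
                            (≡.cong (λ z → + suc z) (toℕ-fromℕ n)))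
    (≡.trans (≡.sym (ℤ.pos-* (n !) (suc n))) (≡.cong +_ (ℕ.*-comm (n !) (suc n)))))

  prodᶠ-differences : ∀ n (a : Fin (suc n)) →
    Z.prodᶠ n (λ k → + toℕ (punchIn a k) ℤ.- + toℕ a) ≡ Z.sign (toℕ a) ℤ.* + (toℕ a ! *ℕ (n ∸ toℕ a) !)
  prodᶠ-differences n fzero = ≡.trans (Z.prodᶠ-cong n (λ k → ℤ.+-identityʳ _))
    (≡.trans (prodᶠ-suc n) (≡.sym (≡.trans (ℤ.*-identityˡ _) (≡.cong +_ (ℕ.+-identityʳ (n !))))))
  prodᶠ-differences (suc n) (fsuc a) = ≡.trans
    (≡.cong (λ w → (+ 0 ℤ.- + suc (toℕ a)) ℤ.* w)
      (≡.trans (Z.prodᶠ-cong n (λ k → suc-difference (toℕ (punchIn a k)) (toℕ a))) (prodᶠ-differences n a)))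
    (≡.trans (lemma (+ suc (toℕ a)) (Z.sign (toℕ a)) (+ (toℕ a ! *ℕ (n ∸ toℕ a) !)))
    (≡.cong (λ w → (ℤ.- Z.sign (toℕ a)) ℤ.* w)
      (≡.trans (≡.sym (ℤ.pos-* (suc (toℕ a)) (toℕ a ! *ℕ (n ∸ toℕ a) !)))
               (≡.cong +_ (≡.sym (ℕ.*-assoc (suc (toℕ a)) (toℕ a !) ((n ∸ toℕ a) !)))))))
    where
    lemma : ∀ a s b → (+ 0 ℤ.- a) ℤ.* (s ℤ.* b) ≡ (ℤ.- s) ℤ.* (a ℤ.* b)
    lemma = solve-∀

  fallingFactorial : ℕ → ℕ → ℕ
  fallingFactorial M zero    = 1
  fallingFactorial M (suc K) = fallingFactorial M K *ℕ (M ∸ K)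

  prodᶠ-fallingFactorial : ∀ M K → Z.prodᶠ K (λ i → + (M ∸ toℕ i)) ≡ + fallingFactorial M K
  prodᶠ-fallingFactorial M zero    = ≡.refl
  prodᶠ-fallingFactorial M (suc K) = ≡.trans (Z.prodᶠ-last K (λ i → + (M ∸ toℕ i)))
    (≡.trans (≡.cong₂ ℤ._*_ (≡.trans (Z.prodᶠ-cong K (λ k → ≡.cong (λ z → + (M ∸ z)) (toℕ-inject₁ k)))
                                     (prodᶠ-fallingFactorial M K))
                            (≡.cong (λ z → + (M ∸ z)) (toℕ-fromℕ K)))
     (≡.sym (ℤ.pos-* (fallingFactorial M K) (M ∸ K))))

  fallingFactorial*! : ∀ M K → K ≤ M → fallingFactorial M K *ℕ (M ∸ K) ! ≡ M !
  fallingFactorial*! M zero    _   = ℕ.+-identityʳ (M !)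
  fallingFactorial*! M (suc K) K<M = ≡.trans (ℕ.*-assoc (fallingFactorial M K) (M ∸ K) ((M ∸ suc K) !))
    (≡.trans (≡.cong (fallingFactorial M K *ℕ_) ([n-k]*[n-k-1]!≡[n-k]! K<M)) (fallingFactorial*! M K (ℕ.<⇒≤ K<M)))

  nCk*k!*[n∸k]! : ∀ {n k} → k ≤ n → (n C k) *ℕ (k ! *ℕ (n ∸ k) !) ≡ n !
  nCk*k!*[n∸k]! {n} {k} k≤n = ≡.trans (≡.cong (_*ℕ (k ! *ℕ (n ∸ k) !)) (nCk≡n!/k![n-k]! k≤n))
    (m/n*n≡m {{ℕ._!*_!≢0 k (n ∸ k)}} (k![n∸k]!∣n! k≤n))

  prodᶠ≢0 : ∀ n (f : Fin n → ℤ) → (∀ i → f i ≢ + 0) → Z.prodᶠ n f ≢ + 0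
  prodᶠ≢0 zero    f nz ()
  prodᶠ≢0 (suc n) f nz e with ℤ.i*j≡0⇒i≡0∨j≡0 (f fzero) e
  ... | inj₁ e₁ = nz fzero e₁
  ... | inj₂ e₂ = prodᶠ≢0 n (tail f) (λ i → nz (fsuc i)) e₂

  vandermonde-staircase≢0 : ∀ n → Z.vandermonde (suc n) (λ i → + (n ∸ toℕ i)) ≢ + 0
  vandermonde-staircase≢0 zero ()
  vandermonde-staircase≢0 (suc n) e
    with ℤ.i*j≡0⇒i≡0∨j≡0 _ (≡.trans (≡.sym (Z.vandermonde-∷ (suc n) (λ i → + (suc n ∸ toℕ i)))) e)
  ... | inj₁ e₁ = prodᶠ≢0 (suc n) _ factor≢0 e₁
    where
    factor≢0 : ∀ j → + suc n ℤ.- + (suc n ∸ suc (toℕ j)) ≢ + 0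
    factor≢0 j e₂ with ℤ.+-injective (≡.trans (≡.sym (≡.trans (≡.sym (+-∸ (ℕ.m∸n≤m (suc n) (suc (toℕ j)))))
                         (≡.cong +_ (ℕ.m∸[m∸n]≡n (s≤s (toℕ≤pred[n] j)))))) e₂)
    ... | ()
  ... | inj₂ e₂ = vandermonde-staircase≢0 n e₂

-- With the staircase d_i = n - i, the shifted exponents of μ are
-- (M, d_k for k ≠ j'), where j' = n - j. Dividing the two Vandermonde
-- products, their common factor over k ≠ j' cancels and leaves
-- Π_{k≠j'} (M - d_k) / Π_{k≠j'} (d_{j'} - d_k), which is the product of
-- binomial coefficients.
module HookAtOnes (M n : ℕ) (N≤M : suc n ≤ M) (s : Fin (suc n) → Expr (suc n))
  (schur : ∀ j → IsSchur (suc n) (hook M (suc n) j) (s j)) (j : Fin (suc n)) where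
  open import Data.Integer as ℤ using (ℤ; +_)
  import Data.Integer.Properties as ℤ
  open import Data.Integer.Base using (≢-nonZero)
  open import Data.Integer.Tactic.RingSolver using (solve-∀)
  open import Data.Nat.Tactic.RingSolver using () renaming (solve-∀ to ℕ-solve-∀)
  open import Data.Nat.Combinatorics using (_C_; [n-k]*[n-k-1]!≡[n-k]!)
  open PrincipalSpecialisation using (module Z; schur-atOnes)
  open StaircaseProducts
  open HookExponents M n N≤M using (exponent; exponent-hook)

  N : ℕ
  N = suc n

  j' : Fin N
  j' = opposite j

  staircase : Fin N → ℕ
  staircase i = n ∸ toℕ i

  commonFactor : ℤ
  commonFactor = Z.vandermonde n (λ k → + staircase (punchIn j' k))

  topProduct : ℤ
  topProduct = Z.prodᶠ n (λ k → + M ℤ.- + staircase (punchIn j' k))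

  hookCount : ℕ
  hookCount = (M C toℕ j) *ℕ ((M ∸ suc (toℕ j)) C (N ∸ suc (toℕ j)))

  G : ℕ
  G = toℕ j' ! *ℕ (n ∸ toℕ j') !

  j≤n : toℕ j ≤ n
  j≤n = toℕ≤pred[n] j

  j<M : toℕ j < M
  j<M = ℕ.≤-trans (s≤s j≤n) N≤M

  j'≡n∸j : toℕ j' ≡ n ∸ toℕ j
  j'≡n∸j = opposite-prop j

  n∸j'≡j : n ∸ toℕ j' ≡ toℕ j
  n∸j'≡j = ≡.trans (≡.cong (n ∸_) j'≡n∸j) (ℕ.m∸[m∸n]≡n j≤n)

  shifted≡ : ∀ k → hook M N j k +ℕ (N ∸ suc (toℕ k)) ≡ (M ∷ (λ k' → staircase (punchIn j' k'))) k
  shifted≡ k = ≡.trans (≡.cong (λ z → hook M N z k +ℕ (N ∸ suc (toℕ k))) (≡.sym (opposite-involutive j)))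
                       (≡.trans (≡.sym (exponent-hook j' k)) (omitted k))
    where
    omitted : ∀ k → exponent (punchIn (fsuc j') k) ≡ (M ∷ (λ k' → staircase (punchIn j' k'))) k
    omitted fzero    = ≡.refl
    omitted (fsuc k) = ≡.refl

  vandermonde-shifted : Z.vandermonde N (λ k → + (hook M N j k +ℕ (N ∸ suc (toℕ k)))) ≡ topProduct ℤ.* commonFactor
  vandermonde-shifted = ≡.trans (Z.vandermonde-cong N (λ k → ≡.cong +_ (shifted≡ k)))
    (≡.trans (Z.vandermonde-cong N {λ k → + (M ∷ (λ k' → staircase (punchIn j' k'))) k}
                                   {+ M ∷ (λ k' → + staircase (punchIn j' k'))} (λ { fzero → ≡.refl ; (fsuc k) → ≡.refl }))
      (Z.vandermonde-∷ n (+ M ∷ (λ k' → + staircase (punchIn j' k')))))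

  vandermonde-staircase : Z.vandermonde N (λ i → + staircase i) ≡ + G ℤ.* commonFactor
  vandermonde-staircase = ≡.trans (Z.vandermonde-moveToFront n (λ i → + staircase i) j')
    (≡.trans (≡.cong (Z.sign (toℕ j') ℤ.*_) (Z.vandermonde-∷ n (+ staircase j' ∷ (λ k → + staircase (punchIn j' k)))))
    (≡.trans (≡.cong (λ z → Z.sign (toℕ j') ℤ.* (z ℤ.* commonFactor)) differences)
    (≡.trans (lemma (Z.sign (toℕ j')) (+ G) commonFactor)
    (≡.trans (≡.cong (ℤ._* (+ G ℤ.* commonFactor)) (Z.sign*sign (toℕ j'))) (ℤ.*-identityˡ _)))))
    where
    differences : Z.prodᶠ n (λ k → + staircase j' ℤ.- + staircase (punchIn j' k)) ≡ Z.sign (toℕ j') ℤ.* + G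
    differences = ≡.trans (Z.prodᶠ-cong n (λ k → staircase-difference n (toℕ j') (toℕ (punchIn j' k))
                                                    (toℕ≤pred[n] j') (toℕ≤pred[n] (punchIn j' k))))
                          (prodᶠ-differences n j')
    lemma : ∀ s g w → s ℤ.* ((s ℤ.* g) ℤ.* w) ≡ (s ℤ.* s) ℤ.* (g ℤ.* w)
    lemma = solve-∀

  G*hookCount*[M∸N]! : ((M ∸ toℕ j) *ℕ (G *ℕ hookCount)) *ℕ (M ∸ N) ! ≡ M !
  G*hookCount*[M∸N]! = begin
    ((M ∸ toℕ j) *ℕ (G *ℕ hookCount)) *ℕ (M ∸ N) !
      ≡⟨ ≡.cong (λ g → ((M ∸ toℕ j) *ℕ (g *ℕ hookCount)) *ℕ (M ∸ N) !) (≡.cong₂ (λ x y → x ! *ℕ y !) j'≡n∸j n∸j'≡j) ⟩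
    ((M ∸ toℕ j) *ℕ (((n ∸ toℕ j) ! *ℕ toℕ j !) *ℕ ((M C toℕ j) *ℕ C₂))) *ℕ (M ∸ N) !
      ≡⟨ rearrange (M ∸ toℕ j) ((n ∸ toℕ j) !) (toℕ j !) (M C toℕ j) C₂ ((M ∸ N) !) ⟩
    (M C toℕ j) *ℕ (toℕ j ! *ℕ ((M ∸ toℕ j) *ℕ (C₂ *ℕ ((n ∸ toℕ j) ! *ℕ (M ∸ N) !))))
      ≡⟨ ≡.cong (λ z → (M C toℕ j) *ℕ (toℕ j ! *ℕ ((M ∸ toℕ j) *ℕ z))) second-binomial ⟩
    (M C toℕ j) *ℕ (toℕ j ! *ℕ ((M ∸ toℕ j) *ℕ (M ∸ suc (toℕ j)) !))
      ≡⟨ ≡.cong (λ z → (M C toℕ j) *ℕ (toℕ j ! *ℕ z)) ([n-k]*[n-k-1]!≡[n-k]! j<M) ⟩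
    (M C toℕ j) *ℕ (toℕ j ! *ℕ (M ∸ toℕ j) !)
      ≡⟨ nCk*k!*[n∸k]! (ℕ.<⇒≤ j<M) ⟩
    M ! ∎
    where
    open ≡.≡-Reasoning
    C₂ = (M ∸ suc (toℕ j)) C (N ∸ suc (toℕ j))
    rearrange : ∀ x₁ x₂ x₃ x₄ x₅ x₆ → (x₁ *ℕ ((x₂ *ℕ x₃) *ℕ (x₄ *ℕ x₅))) *ℕ x₆ ≡ x₄ *ℕ (x₃ *ℕ (x₁ *ℕ (x₅ *ℕ (x₂ *ℕ x₆))))
    rearrange = ℕ-solve-∀
    M∸j∸1∸[n∸j]≡M∸N : (M ∸ suc (toℕ j)) ∸ (n ∸ toℕ j) ≡ M ∸ N
    M∸j∸1∸[n∸j]≡M∸N = ≡.trans (ℕ.∸-+-assoc M (suc (toℕ j)) (n ∸ toℕ j)) (≡.cong (λ z → M ∸ suc z) (ℕ.m+[n∸m]≡n j≤n))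
    second-binomial : C₂ *ℕ ((n ∸ toℕ j) ! *ℕ (M ∸ N) !) ≡ (M ∸ suc (toℕ j)) !
    second-binomial = ≡.trans (≡.cong (λ z → C₂ *ℕ ((n ∸ toℕ j) ! *ℕ z !)) (≡.sym M∸j∸1∸[n∸j]≡M∸N))
                              (nCk*k!*[n∸k]! (ℕ.∸-monoˡ-≤ (suc (toℕ j)) N≤M))

  -- The factor missing from topProduct, at k = j', is M - d_{j'} = M - j.
  [M∸j]*topProduct : + (M ∸ toℕ j) ℤ.* topProduct ≡ + fallingFactorial M N
  [M∸j]*topProduct = ≡.trans
    (≡.sym (≡.cong (ℤ._* topProduct) (≡.trans (≡.sym (+-∸ (d≤M j'))) (≡.cong (λ z → + (M ∸ z)) n∸j'≡j))))
    (≡.trans (≡.sym (Z.prodᶠ-punchIn n (λ i → + M ℤ.- + staircase i) j'))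
    (≡.trans (Z.prodᶠ-cong (suc n) (λ i → ≡.trans (≡.sym (+-∸ (d≤M i))) (≡.cong (λ z → + (M ∸ z)) (≡.sym (opposite-prop i)))))
    (≡.trans (Z.prodᶠ-opposite (suc n) (λ i → + (M ∸ toℕ i))) (prodᶠ-fallingFactorial M N))))
    where
    d≤M : ∀ i → staircase i ≤ M
    d≤M i = ℕ.≤-trans (ℕ.m∸n≤m n (toℕ i)) (ℕ.<⇒≤ N≤M)

  topProduct≡G*hookCount : topProduct ≡ + (G *ℕ hookCount)
  topProduct≡G*hookCount = ℤ.*-cancelˡ-≡ (+ (M ∸ toℕ j)) topProduct (+ (G *ℕ hookCount))
    {{ℕ.>-nonZero (ℕ.m<n⇒0<n∸m j<M)}}
    (≡.trans [M∸j]*topProduct (≡.trans (≡.cong +_ (≡.sym full-product)) (ℤ.pos-* (M ∸ toℕ j) (G *ℕ hookCount))))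
    where
    full-product : (M ∸ toℕ j) *ℕ (G *ℕ hookCount) ≡ fallingFactorial M N
    full-product = ℕ.*-cancelʳ-≡ _ _ ((M ∸ N) !) {{(M ∸ N) ℕ.!≢0}}
      (≡.trans G*hookCount*[M∸N]! (≡.sym (fallingFactorial*! M N N≤M)))

  hook-atOnes : eval (CommutativeRing.rawRing PrincipalSpecialisation.ℤ-ring) (λ _ → + 1) (s j) ≡ + hookCount
  hook-atOnes = ℤ.*-cancelʳ-≡ _ (+ hookCount) (Z.vandermonde N (λ i → + staircase i))
    {{≢-nonZero (vandermonde-staircase≢0 n)}}
    (≡.trans (schur-atOnes N (hook M N j) (s j) (schur j))
    (≡.trans vandermonde-shifted
    (≡.trans (≡.cong (ℤ._* commonFactor) (≡.trans topProduct≡G*hookCount (ℤ.pos-* G hookCount)))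
    (≡.trans (lemma (+ G) (+ hookCount) commonFactor)
    (≡.trans (≡.cong (ℤ._* + hookCount) (≡.sym vandermonde-staircase))
             (ℤ.*-comm (Z.vandermonde N (λ i → + staircase i)) (+ hookCount)))))))
    where
    lemma : ∀ g c w → (g ℤ.* c) ℤ.* w ≡ (g ℤ.* w) ℤ.* c
    lemma = solve-∀

open import Data.Nat.Combinatorics using (_C_)
open import Data.Integer using (+_)
open import Data.Integer.Properties using (+-*-commutativeRing)

theorem6 : ∀ {a ℓ} (F : Field a ℓ) (M N : ℕ) → 1 ≤ N → N ≤ M →
  (c : Fin N → Field.Carrier F) → (∀ j → ¬ (Field._≈_ F (c j) (Field.0# F))) →
  (s : Fin N → Expr N) → (∀ j → IsSchur N (hook M N j) (s j)) →
  (∀ (u v : Fin N → Field.Carrier F) →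
    let open Field F
        open RingOps rawRing
        open Series F
        module T = RawRing psRing
        module P = RingOps psRing
        -- p_t(z) = t (c_0 + c_1 z + … + c_{N-1} z^{N-1}) - z^M, a polynomial in t
        pₜ : Carrier → PS
        pₜ z = (tVar T.* const (sumᶠ N (λ m → c m * pow z (toℕ m))))
                 T.+ (T.- const (pow z M))
    in P.det N (λ i k → pₜ (u i * v k))
       T.≈ (P.pow tVar (N ∸ 1)
             T.* (const (vandermonde N u * vandermonde N v * prodᶠ N c)
             T.* (tVar T.+ (T.- const (sumᶠ N (λ j →
                   eval rawRing u (s j) * eval rawRing v (s j) * (c j ⁻¹)))))))) ×
  (∀ j → eval (CommutativeRing.rawRing +-*-commutativeRing) (λ _ → + 1) (s j)
           ≡ + ((M C toℕ j) *ℕ ((M ∸ suc (toℕ j)) C (N ∸ suc (toℕ j)))))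
theorem6 F M (suc n) (s≤s z≤n) N≤M c c≢0 s schur =
  DeterminantFormula.det-pₜ[uvᵀ] F M n N≤M c c≢0 s schur ,
  HookAtOnes.hook-atOnes M n N≤M s schur
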